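{- Let $I\subseteq\mathbb{Z}^+$ be a finite nonempty set with $m=\max(I)$, let $I^-=I\setminus\{m\}$ and $m^-=\max(I^-\cup\{0\})$. Then for every $0\le k\le m$, \[ c_k(I)=d(I^-,m)-(-1)^{m-m^- }c_k(I^-). \]
   Context: For a finite set $J\subseteq\mathbb{Z}^+$ let $m(J)=\max(J\cup\{0\})$. For integers $n>m(J)$, $d(J,n)$ is the number of permutations of $[n]$ with descent set exactly $J$ (descent set of $\pi$ is $\{i\in[n-1]:\pi_i>\pi_{i+1}\}$); there is a unique polynomial in $n$ of degree $m(J)$ agreeing with this count for all integers $n>m(J)$, and $d(J,n)$ denotes this polynomial. The coefficients $c_k(J)$ are defined by $d(J,n)=\sum_{k=0}^{m(J)}(-1)^{m(J)-k}c_k(J)\binom{n+1}{k}$, with $c_k(J)=0$ for $k>m(J)$, where $\binom{w}{k}=w(w-1)\cdots(w-k+1)/k!$. -}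

module Defs where

open import Data.Bool using (Bool; true; false; _∧_; _∨_; not; if_then_else_; T?)
open import Data.Nat using (ℕ; zero; suc; _<ᵇ_; _≡ᵇ_; _⊔_; _∸_; _≟_; _<_)
open import Data.Nat.Combinatorics using (_C_)
open import Data.List using (List; []; _∷_; map; concatMap; filter; length; foldr; applyUpTo)
open import Data.Bool.ListAction using (all)
open import Data.Integer using (ℤ; +_; -_; _*_) renaming (_+_ to _+ℤ_)
open import Data.Product using (_×_)
open import Relation.Nullary.Decidable using (¬?)
open import Relation.Binary.PropositionalEquality using (_≡_)

-- Finite sets J ⊆ ℤ⁺ are represented by lists of naturals (order and
-- repetitions irrelevant); membership is boolean.
elem : ℕ → List ℕ → Bool
elem x []       = false
elem x (y ∷ ys) = (x ≡ᵇ y) ∨ elem x ys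

mx : List ℕ → ℕ
mx = foldr _⊔_ 0

remove : ℕ → List ℕ → List ℕ
remove a = filter (λ x → ¬? (x ≟ a))

words : ℕ → ℕ → List (List ℕ)
words n zero    = [] ∷ []
words n (suc k) = concatMap (λ w → map (_∷ w) (applyUpTo suc n)) (words n k)

distinct : List ℕ → Bool
distinct []       = true
distinct (x ∷ xs) = not (elem x xs) ∧ distinct xs

-- permutations of [n] in one-line notation π₁…πₙ
perms : ℕ → List (List ℕ)
perms n = filter (λ w → T? (distinct w)) (words n n)

-- descents of π, positions counted starting from i
descentsFrom : ℕ → List ℕ → List ℕ
descentsFrom i []            = []
descentsFrom i (x ∷ [])      = []
descentsFrom i (x ∷ y ∷ xs)  =
  if y <ᵇ x then i ∷ descentsFrom (suc i) (y ∷ xs) else descentsFrom (suc i) (y ∷ xs)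

descentSet : List ℕ → List ℕ
descentSet = descentsFrom 1

boolEq : Bool → Bool → Bool
boolEq true  b = b
boolEq false b = not b

hasDescentSet : ℕ → List ℕ → List ℕ → Bool
hasDescentSet n J π =
  all (λ j → (0 <ᵇ j) ∧ (j <ᵇ n)) J ∧
  all (λ i → boolEq (elem i J) (elem i (descentSet π))) (applyUpTo suc (n ∸ 1))

-- number of permutations of [n] with descent set exactly J
-- (this is d(J,n) for n > m(J))
dCount : List ℕ → ℕ → ℕ
dCount J n = length (filter (λ π → T? (hasDescentSet n J π)) (perms n))

sgn : ℕ → ℤ
sgn zero          = + 1
sgn (suc zero)    = - + 1
sgn (suc (suc e)) = sgn e

sumTo : ℕ → (ℕ → ℤ) → ℤ
sumTo zero    f = f 0
sumTo (suc m) f = sumTo m f +ℤ f (suc m)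

-- c : ℕ → ℤ is the coefficient sequence c_k(J):
--   c_k = 0 for k > m(J), and for all integers n > m(J)
--   d(J,n) = Σ_{k=0}^{m(J)} (-1)^{m(J)-k} c_k (n+1 choose k).
-- (A polynomial of degree ≤ m(J) is determined by its values at n > m(J),
--  so these conditions determine c uniquely.)
IsCoeffs : List ℕ → (ℕ → ℤ) → Set
IsCoeffs J c =
  (∀ k → mx J < k → c k ≡ + 0) ×
  (∀ n → mx J < n →
     + dCount J n ≡ sumTo (mx J) (λ k → sgn (mx J ∸ k) * (c k * + (suc n C k))))

module Submission where

-- The proof has an algebraic and a combinatorial half.
--  * BinomialExpansions: writing value m c n = Σ_k (-1)^{m-k} c_k (n+1 choose k),
--    the polynomials (n+1 choose k) are linearly independent, value m is linear,
--    a constant D expands as D·(n choose m), and a sequence supported on [0,m⁻] can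
--    be read in degree m up to the sign (-1)^{m-m⁻}.  Hence the counting identity
--          d(I,n) + d(I⁻,n) = (n choose m)·d(I⁻,m)     for all n > m       (★)
--    yields the lemma (coefficient-recursion).
--  * The remaining modules prove (★).  A permutation of [n] matching I⁻ away from
--    position m has descent set I or I⁻, never both; it is determined by the set S
--    of its first m values (n choose m choices), an ordering of S with descent set
--    I⁻ (d(I⁻,m) choices, after relabelling S order-preservingly to [m]) and the
--    increasing ordering of the rest.  To carry this out, permutations of [n] are
--    identified with the orderings (repetition-free arrangements) of the list [1..n],
--    and sums over orderings are split along the first m entries.

open import Defs

module BinomialExpansions where
  open import Data.Nat as ℕ using (ℕ; zero; suc; _<_; _≤_; _∸_; z≤n; s≤s)
  import Data.Nat.Properties as ℕₚ
  open import Data.Nat.Combinatorics using (_C_; nCk+nC[k+1]≡[n+1]C[k+1])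
  open import Data.Integer using (ℤ; +_; -_; _*_; _+_; _-_)
  open import Data.Integer.Properties
    using (pos-+; pos-*; -1*i≡-i; *-identityˡ; *-identityʳ; +-identityˡ; +-identityʳ; *-zeroʳ; +-inverseʳ; *-assoc; i-j≡0⇒i≡j)
  open import Data.Integer.Tactic.RingSolver using (solve-∀)
  open import Relation.Binary.PropositionalEquality
  open import Relation.Nullary using (yes; no)
  open ≡-Reasoning

  sgn-suc : ∀ e → sgn (suc e) ≡ - sgn e
  sgn-suc zero          = refl
  sgn-suc (suc zero)    = refl
  sgn-suc (suc (suc e)) = sgn-suc e

  sgn-+ : ∀ a b → sgn (a ℕ.+ b) ≡ sgn a * sgn b
  sgn-+ zero          b = sym (*-identityˡ (sgn b))
  sgn-+ (suc zero)    b = trans (sgn-suc b) (sym (-1*i≡-i (sgn b)))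
  sgn-+ (suc (suc a)) b = sgn-+ a b

  sgn-square : ∀ a → sgn a * sgn a ≡ + 1
  sgn-square zero          = refl
  sgn-square (suc zero)    = refl
  sgn-square (suc (suc a)) = sgn-square a

  sgn-cancel : ∀ a x → sgn a * (sgn a * x) ≡ x
  sgn-cancel a x = begin
    sgn a * (sgn a * x) ≡⟨ sym (*-assoc (sgn a) (sgn a) x) ⟩
    sgn a * sgn a * x   ≡⟨ cong (_* x) (sgn-square a) ⟩
    + 1 * x             ≡⟨ *-identityˡ x ⟩
    x                   ∎

  sumTo-cong : ∀ m (f g : ℕ → ℤ) → (∀ k → k ≤ m → f k ≡ g k) → sumTo m f ≡ sumTo m g
  sumTo-cong zero    f g f≗g = f≗g 0 z≤n
  sumTo-cong (suc m) f g f≗g =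
    cong₂ _+_ (sumTo-cong m f g (λ k k≤m → f≗g k (ℕₚ.m≤n⇒m≤1+n k≤m))) (f≗g (suc m) ℕₚ.≤-refl)

  sumTo-+ : ∀ m (f g : ℕ → ℤ) → sumTo m (λ k → f k + g k) ≡ sumTo m f + sumTo m g
  sumTo-+ zero    f g = refl
  sumTo-+ (suc m) f g rewrite sumTo-+ m f g = interchange (sumTo m f) (sumTo m g) (f (suc m)) (g (suc m))
    where
    interchange : ∀ a b c d → a + b + (c + d) ≡ a + c + (b + d)
    interchange = solve-∀

  sumTo-*ˡ : ∀ m a (f : ℕ → ℤ) → sumTo m (λ k → a * f k) ≡ a * sumTo m f
  sumTo-*ˡ zero    a f = refl
  sumTo-*ˡ (suc m) a f rewrite sumTo-*ˡ m a f = distrib a (sumTo m f) (f (suc m))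
    where
    distrib : ∀ a b c → a * b + a * c ≡ a * (b + c)
    distrib = solve-∀

  sumTo-- : ∀ m (f g : ℕ → ℤ) → sumTo m (λ k → f k - g k) ≡ sumTo m f - sumTo m g
  sumTo-- zero    f g = refl
  sumTo-- (suc m) f g rewrite sumTo-- m f g = interchange (sumTo m f) (sumTo m g) (f (suc m)) (g (suc m))
    where
    interchange : ∀ a b c d → a - b + (c - d) ≡ a + c - (b + d)
    interchange = solve-∀

  sumTo-zero : ∀ m → sumTo m (λ _ → + 0) ≡ + 0
  sumTo-zero zero    = refl
  sumTo-zero (suc m) = trans (+-identityʳ (sumTo m (λ _ → + 0))) (sumTo-zero m)

  sumTo-suc : ∀ m (f : ℕ → ℤ) → sumTo (suc m) f ≡ f 0 + sumTo m (λ k → f (suc k))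
  sumTo-suc zero    f = refl
  sumTo-suc (suc m) f rewrite sumTo-suc m f =
    assoc (f 0) (sumTo m (λ k → f (suc k))) (f (suc (suc m)))
    where
    assoc : ∀ a b c → a + b + c ≡ a + (b + c)
    assoc = solve-∀

  sumTo-vanishing-tail : ∀ m m₁ (f : ℕ → ℤ) → m₁ ≤ m →
    (∀ k → m₁ < k → f k ≡ + 0) → sumTo m f ≡ sumTo m₁ f
  sumTo-vanishing-tail m m₁ f m₁≤m f≡0 =
    trans (cong (λ x → sumTo x f) (sym (ℕₚ.m∸n+n≡m m₁≤m))) (drop (m ∸ m₁))
    where
    drop : ∀ d → sumTo (d ℕ.+ m₁) f ≡ sumTo m₁ f
    drop zero    = refl
    drop (suc d) = begin
      sumTo (d ℕ.+ m₁) f + f (suc (d ℕ.+ m₁)) ≡⟨ cong₂ _+_ (drop d) (f≡0 _ (s≤s (ℕₚ.m≤n+m m₁ d))) ⟩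
      sumTo m₁ f + + 0                        ≡⟨ +-identityʳ (sumTo m₁ f) ⟩
      sumTo m₁ f                              ∎

  value : ℕ → (ℕ → ℤ) → ℕ → ℤ
  value m c n = sumTo m (λ k → sgn (m ∸ k) * (c k * + (suc n C k)))

  -- (n choose m) = Σ_{k=0}^{m} (-1)^{m-k} (n+1 choose k), by Pascal's rule.
  binomial-alternating : ∀ m n → + (n C m) ≡ sumTo m (λ k → sgn (m ∸ k) * + (suc n C k))
  binomial-alternating zero    n = refl
  binomial-alternating (suc m) n = begin
    + (n C suc m)
      ≡⟨ pascal ⟩
    - + (n C m) + B (suc m)
      ≡⟨ cong (λ x → - x + B (suc m)) (binomial-alternating m n) ⟩
    - sumTo m (λ k → sgn (m ∸ k) * B k) + B (suc m)
      ≡⟨ cong (_+ B (suc m)) (trans (sym (-1*i≡-i _)) (sym (sumTo-*ˡ m (- + 1) _))) ⟩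
    sumTo m (λ k → - + 1 * (sgn (m ∸ k) * B k)) + B (suc m)
      ≡⟨ cong₂ _+_ (sumTo-cong m _ _ flip-sign) top-term ⟩
    sumTo (suc m) (λ k → sgn (suc m ∸ k) * B k)
      ∎
    where
    B : ℕ → ℤ
    B k = + (suc n C k)
    pascal : + (n C suc m) ≡ - + (n C m) + B (suc m)
    pascal = begin
      + (n C suc m)                           ≡⟨ cancel (+ (n C m)) (+ (n C suc m)) ⟩
      - + (n C m) + (+ (n C m) + + (n C suc m)) ≡⟨ cong (λ x → - + (n C m) + x) (sym (pos-+ (n C m) (n C suc m))) ⟩
      - + (n C m) + + (n C m ℕ.+ n C suc m)     ≡⟨ cong (λ x → - + (n C m) + + x) (nCk+nC[k+1]≡[n+1]C[k+1] n m) ⟩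
      - + (n C m) + B (suc m)                   ∎
      where
      cancel : ∀ x y → y ≡ - x + (x + y)
      cancel = solve-∀
    top-term : B (suc m) ≡ sgn (suc m ∸ suc m) * B (suc m)
    top-term = trans (sym (*-identityˡ (B (suc m)))) (cong (λ e → sgn e * B (suc m)) (sym (ℕₚ.n∸n≡0 m)))
    flip-sign : ∀ k → k ≤ m → - + 1 * (sgn (m ∸ k) * B k) ≡ sgn (suc m ∸ k) * B k
    flip-sign k k≤m rewrite ℕₚ.+-∸-assoc 1 k≤m | sgn-suc (m ∸ k) = neg-assoc (sgn (m ∸ k)) (B k)
      where
      neg-assoc : ∀ x y → - + 1 * (x * y) ≡ - x * y
      neg-assoc = solve-∀

  -- Pascal's rule applied termwise: the forward difference in n of a sum over the
  -- basis (n+1 choose k) is the sum with shifted coefficients.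
  binomial-sum-difference : ∀ m (e : ℕ → ℤ) n →
    sumTo (suc m) (λ k → e k * + (suc (suc n) C k))
      ≡ sumTo (suc m) (λ k → e k * + (suc n C k)) + sumTo m (λ k → e (suc k) * + (suc n C k))
  binomial-sum-difference m e n = begin
    sumTo (suc m) (λ k → e k * B (suc n) k)
      ≡⟨ sumTo-suc m _ ⟩
    e 0 * + 1 + sumTo m (λ k → e (suc k) * B (suc n) (suc k))
      ≡⟨ cong (λ x → e 0 * + 1 + x) (trans (sumTo-cong m _ _ (λ k _ → pascal k)) (sumTo-+ m _ _)) ⟩
    e 0 * + 1 + (sumTo m (λ k → e (suc k) * B n (suc k)) + sumTo m (λ k → e (suc k) * B n k))
      ≡⟨ reassoc (e 0 * + 1) _ _ ⟩
    e 0 * + 1 + sumTo m (λ k → e (suc k) * B n (suc k)) + sumTo m (λ k → e (suc k) * B n k)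
      ≡⟨ cong (_+ sumTo m (λ k → e (suc k) * B n k)) (sym (sumTo-suc m _)) ⟩
    sumTo (suc m) (λ k → e k * B n k) + sumTo m (λ k → e (suc k) * B n k)
      ∎
    where
    B : ℕ → ℕ → ℤ
    B n k = + (suc n C k)
    reassoc : ∀ a b c → a + (b + c) ≡ a + b + c
    reassoc = solve-∀
    pascal : ∀ k → e (suc k) * B (suc n) (suc k) ≡ e (suc k) * B n (suc k) + e (suc k) * B n k
    pascal k rewrite sym (nCk+nC[k+1]≡[n+1]C[k+1] (suc n) k) | pos-+ (suc n C k) (suc n C suc k) =
      distrib (e (suc k)) (B n k) (B n (suc k))
      where
      distrib : ∀ a b c → a * (b + c) ≡ a * c + a * b
      distrib = solve-∀

  -- The polynomials (n+1 choose k), k ≤ m, are linearly independent: a combination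
  -- vanishing for all large n has all coefficients zero.  Induction on m, taking
  -- differences in n.
  binomial-independence : ∀ m (e : ℕ → ℤ) N →
    (∀ n → N < n → sumTo m (λ k → e k * + (suc n C k)) ≡ + 0) →
    ∀ k → k ≤ m → e k ≡ + 0
  binomial-independence zero    e N vanish zero z≤n = trans (sym (*-identityʳ (e 0))) (vanish (suc N) ℕₚ.≤-refl)
  binomial-independence (suc m) e N vanish = coefficient
    where
    shifted-vanish : ∀ n → N < n → sumTo m (λ k → e (suc k) * + (suc n C k)) ≡ + 0
    shifted-vanish n N<n = begin
      sumTo m (λ k → e (suc k) * + (suc n C k))
        ≡⟨ sym (+-identityˡ _) ⟩
      + 0 + sumTo m (λ k → e (suc k) * + (suc n C k))
        ≡⟨ cong (_+ sumTo m (λ k → e (suc k) * + (suc n C k))) (sym (vanish n N<n)) ⟩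
      sumTo (suc m) (λ k → e k * + (suc n C k)) + sumTo m (λ k → e (suc k) * + (suc n C k))
        ≡⟨ sym (binomial-sum-difference m e n) ⟩
      sumTo (suc m) (λ k → e k * + (suc (suc n) C k))
        ≡⟨ vanish (suc n) (ℕₚ.m≤n⇒m≤1+n N<n) ⟩
      + 0
        ∎
    higher : ∀ k → k ≤ m → e (suc k) ≡ + 0
    higher = binomial-independence m (λ k → e (suc k)) N shifted-vanish
    coefficient : ∀ k → k ≤ suc m → e k ≡ + 0
    coefficient (suc k) (s≤s k≤m) = higher k k≤m
    coefficient zero    _         = begin
      e 0                                                        ≡⟨ sym (+-identityʳ (e 0)) ⟩
      e 0 + + 0                                                  ≡⟨ cong₂ _+_ (sym (*-identityʳ (e 0))) (sym higher-terms) ⟩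
      e 0 * + 1 + sumTo m (λ k → e (suc k) * + (suc n C suc k))  ≡⟨ sym (sumTo-suc m _) ⟩
      sumTo (suc m) (λ k → e k * + (suc n C k))                  ≡⟨ vanish n ℕₚ.≤-refl ⟩
      + 0                                                        ∎
      where
      n = suc N
      higher-terms : sumTo m (λ k → e (suc k) * + (suc n C suc k)) ≡ + 0
      higher-terms = begin
        sumTo m (λ k → e (suc k) * + (suc n C suc k)) ≡⟨ sumTo-cong m _ _ (λ k k≤m → cong (_* + (suc n C suc k)) (higher k k≤m)) ⟩
        sumTo m (λ _ → + 0)                           ≡⟨ sumTo-zero m ⟩
        + 0                                           ∎

  value-injective : ∀ m N (a b : ℕ → ℤ) →
    (∀ n → N < n → value m a n ≡ value m b n) → ∀ k → k ≤ m → a k ≡ b k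
  value-injective m N a b same k k≤m = i-j≡0⇒i≡j (a k) (b k) (begin
    a k - b k                                 ≡⟨ sym (sgn-cancel (m ∸ k) (a k - b k)) ⟩
    sgn (m ∸ k) * (sgn (m ∸ k) * (a k - b k)) ≡⟨ cong (sgn (m ∸ k) *_) (signed-difference-zero k k≤m) ⟩
    sgn (m ∸ k) * + 0                         ≡⟨ *-zeroʳ (sgn (m ∸ k)) ⟩
    + 0                                       ∎)
    where
    signed-difference-zero : ∀ k → k ≤ m → sgn (m ∸ k) * (a k - b k) ≡ + 0
    signed-difference-zero = binomial-independence m (λ k → sgn (m ∸ k) * (a k - b k)) N λ n N<n → begin
      sumTo m (λ k → sgn (m ∸ k) * (a k - b k) * + (suc n C k))
        ≡⟨ sumTo-cong m _ _ (λ k _ → distrib (sgn (m ∸ k)) (a k) (b k) (+ (suc n C k))) ⟩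
      sumTo m (λ k → sgn (m ∸ k) * (a k * + (suc n C k)) - sgn (m ∸ k) * (b k * + (suc n C k)))
        ≡⟨ sumTo-- m _ _ ⟩
      value m a n - value m b n
        ≡⟨ cong (λ x → value m a n - x) (sym (same n N<n)) ⟩
      value m a n - value m a n
        ≡⟨ +-inverseʳ (value m a n) ⟩
      + 0
        ∎
      where
      distrib : ∀ s x y B → s * (x - y) * B ≡ s * (x * B) - s * (y * B)
      distrib = solve-∀

  value-const : ∀ m D n → value m (λ _ → D) n ≡ D * + (n C m)
  value-const m D n = begin
    sumTo m (λ k → sgn (m ∸ k) * (D * + (suc n C k))) ≡⟨ sumTo-cong m _ _ (λ k _ → swap (sgn (m ∸ k)) D _) ⟩
    sumTo m (λ k → D * (sgn (m ∸ k) * + (suc n C k))) ≡⟨ sumTo-*ˡ m D _ ⟩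
    D * sumTo m (λ k → sgn (m ∸ k) * + (suc n C k))   ≡⟨ cong (D *_) (sym (binomial-alternating m n)) ⟩
    D * + (n C m)                                     ∎
    where
    swap : ∀ s d B → s * (d * B) ≡ d * (s * B)
    swap = solve-∀

  value-linear : ∀ m (a b : ℕ → ℤ) s n →
    value m (λ k → a k - s * b k) n ≡ value m a n - s * value m b n
  value-linear m a b s n = begin
    sumTo m (λ k → sgn (m ∸ k) * ((a k - s * b k) * B k))
      ≡⟨ sumTo-cong m _ _ (λ k _ → distrib (sgn (m ∸ k)) (a k) s (b k) (B k)) ⟩
    sumTo m (λ k → sgn (m ∸ k) * (a k * B k) - s * (sgn (m ∸ k) * (b k * B k)))
      ≡⟨ sumTo-- m _ _ ⟩
    value m a n - sumTo m (λ k → s * (sgn (m ∸ k) * (b k * B k)))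
      ≡⟨ cong (λ x → value m a n - x) (sumTo-*ˡ m s _) ⟩
    value m a n - s * value m b n
      ∎
    where
    B : ℕ → ℤ
    B k = + (suc n C k)
    distrib : ∀ g x s y B → g * ((x - s * y) * B) ≡ g * (x * B) - s * (g * (y * B))
    distrib = solve-∀

  value-raise : ∀ m m⁻ (b : ℕ → ℤ) n → m⁻ ≤ m → (∀ k → m⁻ < k → b k ≡ + 0) →
    value m b n ≡ sgn (m ∸ m⁻) * value m⁻ b n
  value-raise m m⁻ b n m⁻≤m b≡0 = begin
    sumTo m (λ k → sgn (m ∸ k) * term k)
      ≡⟨ sumTo-cong m _ _ (λ k _ → split-sign k) ⟩
    sumTo m (λ k → s * (sgn (m⁻ ∸ k) * term k))
      ≡⟨ sumTo-*ˡ m s _ ⟩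
    s * sumTo m (λ k → sgn (m⁻ ∸ k) * term k)
      ≡⟨ cong (s *_) (sumTo-vanishing-tail m m⁻ _ m⁻≤m (λ k m⁻<k → vanishing-term k m⁻<k (sgn (m⁻ ∸ k)))) ⟩
    s * value m⁻ b n
      ∎
    where
    s = sgn (m ∸ m⁻)
    term : ℕ → ℤ
    term k = b k * + (suc n C k)
    vanishing-term : ∀ k → m⁻ < k → ∀ g → g * term k ≡ + 0
    vanishing-term k m⁻<k g rewrite b≡0 k m⁻<k = *-zeroʳ g
    split-sign : ∀ k → sgn (m ∸ k) * term k ≡ s * (sgn (m⁻ ∸ k) * term k)
    split-sign k with k ℕ.≤? m⁻
    ... | yes k≤m⁻ = begin
      sgn (m ∸ k) * term k                 ≡⟨ cong (λ e → sgn e * term k) exponent ⟩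
      sgn ((m ∸ m⁻) ℕ.+ (m⁻ ∸ k)) * term k  ≡⟨ cong (_* term k) (sgn-+ (m ∸ m⁻) (m⁻ ∸ k)) ⟩
      s * sgn (m⁻ ∸ k) * term k            ≡⟨ *-assoc s (sgn (m⁻ ∸ k)) (term k) ⟩
      s * (sgn (m⁻ ∸ k) * term k)          ∎
      where
      exponent : m ∸ k ≡ (m ∸ m⁻) ℕ.+ (m⁻ ∸ k)
      exponent = trans (cong (_∸ k) (sym (ℕₚ.m∸n+n≡m m⁻≤m))) (ℕₚ.+-∸-assoc (m ∸ m⁻) k≤m⁻)
    ... | no k≰m⁻ = trans (vanishing-term k (ℕₚ.≰⇒> k≰m⁻) (sgn (m ∸ k)))
                          (sym (trans (cong (s *_) (vanishing-term k (ℕₚ.≰⇒> k≰m⁻) (sgn (m⁻ ∸ k)))) (*-zeroʳ s)))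

  -- The algebraic half of the theorem: the counting recursion
  --   d(I,n) + d(I⁻,n) = (n choose m)·D    (n > m)
  -- forces c_k(I) = D - (-1)^{m-m⁻} c_k(I⁻) for k ≤ m, because both sides are
  -- coefficient sequences of the same polynomial.
  coefficient-recursion : ∀ m m⁻ (dI d⁻ : ℕ → ℕ) D (c c⁻ : ℕ → ℤ) → m⁻ ≤ m →
    (∀ n → m < n → dI n ℕ.+ d⁻ n ≡ (n C m) ℕ.* D) →
    (∀ n → m < n → + dI n ≡ value m c n) →
    (∀ k → m⁻ < k → c⁻ k ≡ + 0) →
    (∀ n → m⁻ < n → + d⁻ n ≡ value m⁻ c⁻ n) →
    ∀ k → k ≤ m → c k ≡ + D - sgn (m ∸ m⁻) * c⁻ k
  coefficient-recursion m m⁻ dI d⁻ D c c⁻ m⁻≤m recursion c-expands c⁻-support c⁻-expands =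
    value-injective m m c (λ k → + D - s * c⁻ k) same-value
    where
    s = sgn (m ∸ m⁻)
    same-value : ∀ n → m < n → value m c n ≡ value m (λ k → + D - s * c⁻ k) n
    same-value n m<n = begin
      value m c n
        ≡⟨ sym (c-expands n m<n) ⟩
      + dI n
        ≡⟨ solve-for-dI (+ dI n) (+ d⁻ n) (+ D * + (n C m)) integer-recursion ⟩
      + D * + (n C m) - + d⁻ n
        ≡⟨ cong₂ _-_ (sym (value-const m (+ D) n)) (c⁻-expands n (ℕₚ.≤-<-trans m⁻≤m m<n)) ⟩
      value m (λ _ → + D) n - value m⁻ c⁻ n
        ≡⟨ cong (λ x → value m (λ _ → + D) n - x) (sym (sgn-cancel (m ∸ m⁻) (value m⁻ c⁻ n))) ⟩
      value m (λ _ → + D) n - s * (s * value m⁻ c⁻ n)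
        ≡⟨ cong (λ x → value m (λ _ → + D) n - s * x) (sym (value-raise m m⁻ c⁻ n m⁻≤m c⁻-support)) ⟩
      value m (λ _ → + D) n - s * value m c⁻ n
        ≡⟨ sym (value-linear m (λ _ → + D) c⁻ s n) ⟩
      value m (λ k → + D - s * c⁻ k) n
        ∎
      where
      integer-recursion : + dI n + + d⁻ n ≡ + D * + (n C m)
      integer-recursion = begin
        + dI n + + d⁻ n          ≡⟨ sym (pos-+ (dI n) (d⁻ n)) ⟩
        + (dI n ℕ.+ d⁻ n)        ≡⟨ cong +_ (trans (recursion n m<n) (ℕₚ.*-comm (n C m) D)) ⟩
        + (D ℕ.* (n C m))        ≡⟨ pos-* D (n C m) ⟩
        + D * + (n C m)          ∎
      solve-for-dI : ∀ x y z → x + y ≡ z → x ≡ z - y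
      solve-for-dI x y z x+y≡z = trans (move x y) (cong (_- y) x+y≡z)
        where
        move : ∀ x y → x ≡ x + y - y
        move = solve-∀

module ListSums where
  open import Data.Nat using (ℕ; _+_; _*_)
  import Data.Nat.Properties as ℕₚ
  open import Data.Nat.Tactic.RingSolver using (solve-∀)
  open import Data.List using (List; []; _∷_; map; concatMap; length; _++_)
  open import Data.List.Relation.Unary.All using (All; []; _∷_)
  open import Function using (_∘_)
  open import Relation.Binary.PropositionalEquality

  ∑ : ∀ {A : Set} → List A → (A → ℕ) → ℕ
  ∑ []       f = 0
  ∑ (x ∷ xs) f = f x + ∑ xs f

  module _ {A : Set} where

    ∑-++ : ∀ xs ys (f : A → ℕ) → ∑ (xs ++ ys) f ≡ ∑ xs f + ∑ ys f
    ∑-++ []       ys f = refl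
    ∑-++ (x ∷ xs) ys f rewrite ∑-++ xs ys f = sym (ℕₚ.+-assoc (f x) _ _)

    ∑-+ : ∀ xs (f g : A → ℕ) → ∑ xs (λ x → f x + g x) ≡ ∑ xs f + ∑ xs g
    ∑-+ []       f g = refl
    ∑-+ (x ∷ xs) f g rewrite ∑-+ xs f g = interchange (f x) (g x) (∑ xs f) (∑ xs g)
      where
      interchange : ∀ a b c d → a + b + (c + d) ≡ a + c + (b + d)
      interchange = solve-∀

    ∑-cong : ∀ xs (f g : A → ℕ) → (∀ x → f x ≡ g x) → ∑ xs f ≡ ∑ xs g
    ∑-cong []       f g f≗g = refl
    ∑-cong (x ∷ xs) f g f≗g = cong₂ _+_ (f≗g x) (∑-cong xs f g f≗g)

    ∑-congᴬ : ∀ {xs} (f g : A → ℕ) → All (λ x → f x ≡ g x) xs → ∑ xs f ≡ ∑ xs g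
    ∑-congᴬ f g []       = refl
    ∑-congᴬ f g (p ∷ ps) = cong₂ _+_ p (∑-congᴬ f g ps)

    ∑-*ʳ : ∀ xs (f : A → ℕ) c → ∑ xs (λ x → f x * c) ≡ ∑ xs f * c
    ∑-*ʳ []       f c = refl
    ∑-*ʳ (x ∷ xs) f c rewrite ∑-*ʳ xs f c = sym (ℕₚ.*-distribʳ-+ c (f x) (∑ xs f))

    ∑-*ˡ : ∀ xs (f : A → ℕ) c → ∑ xs (λ x → c * f x) ≡ c * ∑ xs f
    ∑-*ˡ []       f c = sym (ℕₚ.*-zeroʳ c)
    ∑-*ˡ (x ∷ xs) f c rewrite ∑-*ˡ xs f c = sym (ℕₚ.*-distribˡ-+ c (f x) (∑ xs f))

    ∑-zero : ∀ (xs : List A) → ∑ xs (λ _ → 0) ≡ 0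
    ∑-zero []       = refl
    ∑-zero (x ∷ xs) = ∑-zero xs

    ∑-const : ∀ (xs : List A) c → ∑ xs (λ _ → c) ≡ length xs * c
    ∑-const []       c = refl
    ∑-const (x ∷ xs) c = cong (c +_) (∑-const xs c)

  module _ {A B : Set} where

    ∑-map : ∀ (g : A → B) xs (f : B → ℕ) → ∑ (map g xs) f ≡ ∑ xs (f ∘ g)
    ∑-map g []       f = refl
    ∑-map g (x ∷ xs) f = cong (f (g x) +_) (∑-map g xs f)

    ∑-concatMap : ∀ (g : A → List B) xs (f : B → ℕ) → ∑ (concatMap g xs) f ≡ ∑ xs (λ x → ∑ (g x) f)
    ∑-concatMap g []       f = refl
    ∑-concatMap g (x ∷ xs) f = trans (∑-++ (g x) (concatMap g xs) f) (cong (∑ (g x) f +_) (∑-concatMap g xs f))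

    ∑-comm : ∀ (xs : List A) (ys : List B) (f : A → B → ℕ) →
      ∑ xs (λ x → ∑ ys (λ y → f x y)) ≡ ∑ ys (λ y → ∑ xs (λ x → f x y))
    ∑-comm []       ys f = sym (∑-zero ys)
    ∑-comm (x ∷ xs) ys f =
      trans (cong (∑ ys (f x) +_) (∑-comm xs ys f)) (sym (∑-+ ys (f x) (λ y → ∑ xs (λ x' → f x' y))))

module Arrangements where
  open ListSums
  open import Data.Nat using (ℕ; zero; suc; _+_; _≤_; s≤s)
  import Data.Nat.Properties as ℕₚ
  open import Data.Nat.Combinatorics using (_C_; nCk+nC[k+1]≡[n+1]C[k+1])
  open import Data.List using (List; []; _∷_; map; concatMap; length; _++_)
  open import Data.List.Properties using (length-++; length-map)
  open import Data.List.Relation.Unary.All as All using (All; []; _∷_)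
  open import Data.List.Relation.Unary.All.Properties using (map⁺; ++⁺; concat⁺)
  open import Data.List.Relation.Unary.Any using (here; there)
  open import Data.List.Membership.Propositional using (_∈_)
  open import Data.Product using (_×_; _,_; proj₁; proj₂)
  open import Data.Sum using (_⊎_; inj₁; inj₂)
  open import Function using (_∘_)
  open import Relation.Binary.PropositionalEquality
  open ≡-Reasoning

  module _ {A : Set} where

    picks : List A → List (A × List A)
    picks []       = []
    picks (x ∷ xs) = (x , xs) ∷ map (λ p → proj₁ p , x ∷ proj₂ p) (picks xs)

    -- For a list of distinct entries these
    -- are exactly the injective words of length k.
    arrangements : List A → ℕ → List (List A)
    arrangements L zero    = [] ∷ []
    arrangements L (suc k) = concatMap (λ p → map (proj₁ p ∷_) (arrangements (proj₂ p) k)) (picks L)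

    orderings : List A → List (List A)
    orderings L = arrangements L (length L)

    splits : ℕ → List A → List (List A × List A)
    splits zero    L        = ([] , L) ∷ []
    splits (suc m) []       = []
    splits (suc m) (x ∷ xs) =
      map (λ q → x ∷ proj₁ q , proj₂ q) (splits m xs) ++ map (λ q → proj₁ q , x ∷ proj₂ q) (splits (suc m) xs)

    length-splits : ∀ m L → length (splits m L) ≡ length L C m
    length-splits zero    L        = refl
    length-splits (suc m) []       = refl
    length-splits (suc m) (x ∷ xs) = begin
      length (map _ (splits m xs) ++ map _ (splits (suc m) xs))
        ≡⟨ length-++ (map _ (splits m xs)) ⟩
      length (map _ (splits m xs)) + length (map _ (splits (suc m) xs))
        ≡⟨ cong₂ _+_ (trans (length-map _ (splits m xs)) (length-splits m xs))
                     (trans (length-map _ (splits (suc m) xs)) (length-splits (suc m) xs)) ⟩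
      length xs C m + length xs C suc m
        ≡⟨ nCk+nC[k+1]≡[n+1]C[k+1] (length xs) m ⟩
      suc (length xs) C suc m
        ∎

    ∑-arrangements-suc : ∀ L k (f : List A → ℕ) →
      ∑ (arrangements L (suc k)) f ≡ ∑ (picks L) (λ p → ∑ (arrangements (proj₂ p) k) (λ w → f (proj₁ p ∷ w)))
    ∑-arrangements-suc L k f = trans (∑-concatMap _ (picks L) f)
      (∑-cong (picks L) _ _ (λ p → ∑-map (proj₁ p ∷_) (arrangements (proj₂ p) k) f))

    picks-length : ∀ (L : List A) → All (λ p → suc (length (proj₂ p)) ≡ length L) (picks L)
    picks-length []       = []
    picks-length (x ∷ xs) = refl ∷ map⁺ (All.map (cong suc) (picks-length xs))

    arrangements-length : ∀ (L : List A) k → All (λ w → length w ≡ k) (arrangements L k)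
    arrangements-length L zero    = refl ∷ []
    arrangements-length L (suc k) =
      concat⁺ (map⁺ (All.universal (λ p → map⁺ (All.map (cong suc) (arrangements-length (proj₂ p) k))) (picks L)))

    splits-length : ∀ m (L : List A) →
      All (λ q → length (proj₁ q) ≡ m × length (proj₁ q) + length (proj₂ q) ≡ length L) (splits m L)
    splits-length zero    L        = (refl , refl) ∷ []
    splits-length (suc m) []       = []
    splits-length (suc m) (x ∷ xs) =
      ++⁺ (map⁺ (All.map (λ { (a , b) → cong suc a , cong suc b }) (splits-length m xs)))
          (map⁺ (All.map (λ { {q} (a , b) → a , trans (ℕₚ.+-suc (length (proj₁ q)) (length (proj₂ q))) (cong suc b) })
                         (splits-length (suc m) xs)))

    picks-⊆ : ∀ (L : List A) → All (λ p → proj₁ p ∈ L × All (_∈ L) (proj₂ p)) (picks L)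
    picks-⊆ []       = []
    picks-⊆ (x ∷ xs) =
      (here refl , All.tabulate there) ∷
      map⁺ (All.map (λ { (a , b) → there a , here refl ∷ All.map there b }) (picks-⊆ xs))

    arrangements-⊆ : ∀ (L : List A) k → All (All (_∈ L)) (arrangements L k)
    arrangements-⊆ L zero    = [] ∷ []
    arrangements-⊆ L (suc k) =
      concat⁺ (map⁺ (All.map (λ { {p} (a , b) → map⁺ (All.map (λ c → a ∷ All.map (All.lookup b) c) (arrangements-⊆ (proj₂ p) k)) })
                             (picks-⊆ L)))

    picks-⊇ : ∀ (L : List A) → All (λ p → ∀ z → z ∈ L → z ≡ proj₁ p ⊎ z ∈ proj₂ p) (picks L)
    picks-⊇ []       = []
    picks-⊇ (x ∷ xs) = first ∷ map⁺ (All.map later (picks-⊇ xs))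
      where
      first : ∀ z → z ∈ x ∷ xs → z ≡ x ⊎ z ∈ xs
      first z (here e)  = inj₁ e
      first z (there q) = inj₂ q
      later : ∀ {p} → (∀ z → z ∈ xs → z ≡ proj₁ p ⊎ z ∈ proj₂ p) →
              ∀ z → z ∈ x ∷ xs → z ≡ proj₁ p ⊎ z ∈ x ∷ proj₂ p
      later cover z (here e)  = inj₂ (here e)
      later cover z (there q) with cover z q
      ... | inj₁ e  = inj₁ e
      ... | inj₂ q′ = inj₂ (there q′)

    arrangements-⊇ : ∀ (L : List A) k → length L ≡ k → All (λ w → All (_∈ w) L) (arrangements L k)
    arrangements-⊇ []       zero    _ = [] ∷ []
    arrangements-⊇ (x ∷ xs) (suc k) e =
      concat⁺ (map⁺ (All.zipWith (λ { {p} (cover , len) →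
         map⁺ (All.map (λ {w} rest⊆w → All.tabulate (λ {z} z∈L → extend p w cover rest⊆w z z∈L))
                       (arrangements-⊇ (proj₂ p) k (ℕₚ.suc-injective (trans len e)))) })
         (picks-⊇ (x ∷ xs) , picks-length (x ∷ xs))))
      where
      extend : ∀ p w → (∀ z → z ∈ x ∷ xs → z ≡ proj₁ p ⊎ z ∈ proj₂ p) → All (_∈ w) (proj₂ p) →
               ∀ z → z ∈ x ∷ xs → z ∈ proj₁ p ∷ w
      extend p w cover rest⊆w z z∈L with cover z z∈L
      ... | inj₁ refl = here refl
      ... | inj₂ q    = there (All.lookup rest⊆w q)

    orderings-⊇ : ∀ (L : List A) → All (λ w → All (_∈ w) L) (orderings L)
    orderings-⊇ L = arrangements-⊇ L (length L) refl

  module _ {A B : Set} where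

    ∑-picks-map : ∀ (f : A → B) L (H : B × List B → ℕ) →
      ∑ (picks (map f L)) H ≡ ∑ (picks L) (λ p → H (f (proj₁ p) , map f (proj₂ p)))
    ∑-picks-map f []       H = refl
    ∑-picks-map f (x ∷ xs) H =
      cong (H (f x , map f xs) +_)
        (trans (∑-map _ (picks (map f xs)) H)
          (trans (∑-picks-map f xs _) (sym (∑-map _ (picks xs) _))))

    ∑-arrangements-map : ∀ (f : A → B) k L (G : List B → ℕ) →
      ∑ (arrangements (map f L) k) G ≡ ∑ (arrangements L k) (G ∘ map f)
    ∑-arrangements-map f zero    L G = refl
    ∑-arrangements-map f (suc k) L G =
      trans (∑-arrangements-suc (map f L) k G)
        (trans (∑-picks-map f L _)
          (trans (∑-cong (picks L) _ _ (λ p → ∑-arrangements-map f k (proj₂ p) (λ w → G (f (proj₁ p) ∷ w))))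
            (sym (∑-arrangements-suc L k (G ∘ map f)))))

  -- Double counting the triples (y, S, R) with y ∷ S ∪ R a partition of L and |S| = m:
  -- pick y first and split the rest, or split off an (m+1)-set first and pick y in it.
  module _ {A : Set} where

    Triples : Set
    Triples = A → List A → List A → ℕ

    pickThenSplit : ℕ → List A → Triples → ℕ
    pickThenSplit m L F = ∑ (picks L) (λ p → ∑ (splits m (proj₂ p)) (λ q → F (proj₁ p) (proj₁ q) (proj₂ q)))

    splitThenPick : ℕ → List A → Triples → ℕ
    splitThenPick m L F = ∑ (splits (suc m) L) (λ q → ∑ (picks (proj₁ q)) (λ p → F (proj₁ p) (proj₂ p) (proj₂ q)))

    -- Where the head x of the list can go: it is y, or lies in S, or lies in R.
    inS inR : A → Triples → Triples
    inS x F y S R = F y (x ∷ S) R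
    inR x F y S R = F y S (x ∷ R)

    pickThenSplit-cons : ∀ x xs m F →
      pickThenSplit (suc m) (x ∷ xs) F
        ≡ ∑ (splits (suc m) xs) (λ q → F x (proj₁ q) (proj₂ q))
          + (pickThenSplit m xs (inS x F) + pickThenSplit (suc m) xs (inR x F))
    pickThenSplit-cons x xs m F = cong (∑ (splits (suc m) xs) (λ q → F x (proj₁ q) (proj₂ q)) +_) (begin
      ∑ (map _ (picks xs)) (λ p → ∑ (splits (suc m) (proj₂ p)) (λ q → F (proj₁ p) (proj₁ q) (proj₂ q)))
        ≡⟨ ∑-map _ (picks xs) _ ⟩
      ∑ (picks xs) (λ p → ∑ (map _ (splits m (proj₂ p)) ++ map _ (splits (suc m) (proj₂ p))) (λ q → F (proj₁ p) (proj₁ q) (proj₂ q)))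
        ≡⟨ ∑-cong (picks xs) _ _ (λ p → trans (∑-++ (map _ (splits m (proj₂ p))) _ _)
                                              (cong₂ _+_ (∑-map _ (splits m (proj₂ p)) _) (∑-map _ (splits (suc m) (proj₂ p)) _))) ⟩
      ∑ (picks xs) (λ p → ∑ (splits m (proj₂ p)) (λ q → inS x F (proj₁ p) (proj₁ q) (proj₂ q))
                         + ∑ (splits (suc m) (proj₂ p)) (λ q → inR x F (proj₁ p) (proj₁ q) (proj₂ q)))
        ≡⟨ ∑-+ (picks xs) _ _ ⟩
      pickThenSplit m xs (inS x F) + pickThenSplit (suc m) xs (inR x F)
        ∎)

    splitThenPick-cons : ∀ x xs m F →
      splitThenPick (suc m) (x ∷ xs) F
        ≡ ∑ (splits (suc m) xs) (λ q → F x (proj₁ q) (proj₂ q))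
          + splitThenPick m xs (inS x F) + splitThenPick (suc m) xs (inR x F)
    splitThenPick-cons x xs m F = begin
      ∑ (map _ (splits (suc m) xs) ++ map _ (splits (suc (suc m)) xs)) G
        ≡⟨ ∑-++ (map _ (splits (suc m) xs)) _ G ⟩
      ∑ (map _ (splits (suc m) xs)) G + ∑ (map _ (splits (suc (suc m)) xs)) G
        ≡⟨ cong₂ _+_ (trans (∑-map _ (splits (suc m) xs) G) x-in-S) (∑-map _ (splits (suc (suc m)) xs) G) ⟩
      ∑ (splits (suc m) xs) (λ q → F x (proj₁ q) (proj₂ q)) + splitThenPick m xs (inS x F)
        + splitThenPick (suc m) xs (inR x F)
        ∎
      where
      G : List A × List A → ℕ
      G q = ∑ (picks (proj₁ q)) (λ p → F (proj₁ p) (proj₂ p) (proj₂ q))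
      x-in-S : ∑ (splits (suc m) xs) (λ q → G (x ∷ proj₁ q , proj₂ q))
             ≡ ∑ (splits (suc m) xs) (λ q → F x (proj₁ q) (proj₂ q)) + splitThenPick m xs (inS x F)
      x-in-S = trans (∑-cong (splits (suc m) xs) _ _ (λ q → cong (F x (proj₁ q) (proj₂ q) +_) (∑-map _ (picks (proj₁ q)) _)))
                     (∑-+ (splits (suc m) xs) _ _)

    pick-split-exchange : ∀ L m F → pickThenSplit m L F ≡ splitThenPick m L F
    pick-split-exchange []       m       F = refl
    pick-split-exchange (x ∷ xs) zero    F = begin
      F x [] xs + 0 + ∑ (map _ (picks xs)) _
        ≡⟨ cong (F x [] xs + 0 +_) (∑-map _ (picks xs) _) ⟩
      F x [] xs + 0 + pickThenSplit 0 xs (inR x F)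
        ≡⟨ cong (F x [] xs + 0 +_) (pick-split-exchange xs 0 (inR x F)) ⟩
      F x [] xs + 0 + splitThenPick 0 xs (inR x F)
        ≡⟨ cong (F x [] xs + 0 +_) (sym (∑-map _ (splits 1 xs) _)) ⟩
      splitThenPick 0 (x ∷ xs) F
        ∎
    pick-split-exchange (x ∷ xs) (suc m) F = begin
      pickThenSplit (suc m) (x ∷ xs) F
        ≡⟨ pickThenSplit-cons x xs m F ⟩
      head + (pickThenSplit m xs (inS x F) + pickThenSplit (suc m) xs (inR x F))
        ≡⟨ cong (head +_) (cong₂ _+_ (pick-split-exchange xs m (inS x F)) (pick-split-exchange xs (suc m) (inR x F))) ⟩
      head + (splitThenPick m xs (inS x F) + splitThenPick (suc m) xs (inR x F))
        ≡⟨ sym (ℕₚ.+-assoc head _ _) ⟩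
      head + splitThenPick m xs (inS x F) + splitThenPick (suc m) xs (inR x F)
        ≡⟨ sym (splitThenPick-cons x xs m F) ⟩
      splitThenPick (suc m) (x ∷ xs) F
        ∎
      where
      head = ∑ (splits (suc m) xs) (λ q → F x (proj₁ q) (proj₂ q))

    ∑-concatenations : List A → List A → (List A → ℕ) → ℕ
    ∑-concatenations S R Q = ∑ (orderings S) (λ u → ∑ (orderings R) (λ v → Q (u ++ v)))

    orderings-split : ∀ m (L : List A) (Q : List A → ℕ) → m ≤ length L →
      ∑ (orderings L) Q ≡ ∑ (splits m L) (λ q → ∑-concatenations (proj₁ q) (proj₂ q) Q)
    orderings-split zero    L        Q _         = sym (trans (ℕₚ.+-identityʳ _) (ℕₚ.+-identityʳ _))
    orderings-split (suc m) (x ∷ xs) Q (s≤s m≤) = begin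
      ∑ (arrangements L (suc (length xs))) Q
        ≡⟨ ∑-arrangements-suc L (length xs) Q ⟩
      ∑ (picks L) (λ p → ∑ (arrangements (proj₂ p) (length xs)) (λ w → Q (proj₁ p ∷ w)))
        ≡⟨ ∑-congᴬ _ _ (All.map (λ {p} len → split-rest p (ℕₚ.suc-injective len)) (picks-length L)) ⟩
      pickThenSplit m L F
        ≡⟨ pick-split-exchange L m F ⟩
      splitThenPick m L F
        ≡⟨ ∑-congᴬ _ _ (All.map (λ {q} len → join-first q (proj₁ len)) (splits-length (suc m) L)) ⟩
      ∑ (splits (suc m) L) (λ q → ∑-concatenations (proj₁ q) (proj₂ q) Q)
        ∎
      where
      L = x ∷ xs
      F : Triples
      F y S R = ∑-concatenations S R (λ w → Q (y ∷ w))
      split-rest : ∀ p → length (proj₂ p) ≡ length xs →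
        ∑ (arrangements (proj₂ p) (length xs)) (λ w → Q (proj₁ p ∷ w))
          ≡ ∑ (splits m (proj₂ p)) (λ q → F (proj₁ p) (proj₁ q) (proj₂ q))
      split-rest (y , rest) len =
        trans (cong (λ k → ∑ (arrangements rest k) (λ w → Q (y ∷ w))) (sym len))
              (orderings-split m rest (λ w → Q (y ∷ w)) (subst (m ≤_) (sym len) m≤))
      join-first : ∀ q → length (proj₁ q) ≡ suc m →
        ∑ (picks (proj₁ q)) (λ p → F (proj₁ p) (proj₂ p) (proj₂ q)) ≡ ∑-concatenations (proj₁ q) (proj₂ q) Q
      join-first (S , R) len = begin
        ∑ (picks S) (λ p → F (proj₁ p) (proj₂ p) R)
          ≡⟨ ∑-congᴬ _ _ (All.map (λ {p} len′ → cong (λ k → ∑ (arrangements (proj₂ p) k) _) (ℕₚ.suc-injective (trans len′ len)))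
                                  (picks-length S)) ⟩
        ∑ (picks S) (λ p → ∑ (arrangements (proj₂ p) m) (λ u → ∑ (orderings R) (λ v → Q (proj₁ p ∷ u ++ v))))
          ≡⟨ sym (∑-arrangements-suc S m (λ u → ∑ (orderings R) (λ v → Q (u ++ v)))) ⟩
        ∑ (arrangements S (suc m)) (λ u → ∑ (orderings R) (λ v → Q (u ++ v)))
          ≡⟨ cong (λ k → ∑ (arrangements S k) (λ u → ∑ (orderings R) (λ v → Q (u ++ v)))) (sym len) ⟩
        ∑-concatenations S R Q
          ∎

module BooleanFacts where
  open import Data.Nat using (ℕ; zero; suc; _*_; _<_; _≤_; _<ᵇ_; _≡ᵇ_; s≤s)
  open import Data.Bool using (Bool; true; false; not; _∧_; _∨_)
  open import Data.Empty using (⊥-elim)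
  open import Relation.Nullary using (¬_)
  open import Relation.Binary.PropositionalEquality

  𝟙 : Bool → ℕ
  𝟙 true  = 1
  𝟙 false = 0

  𝟙-∧ : ∀ a b → 𝟙 (a ∧ b) ≡ 𝟙 a * 𝟙 b
  𝟙-∧ true  true  = refl
  𝟙-∧ true  false = refl
  𝟙-∧ false b     = refl

  not-∨ : ∀ p q → not (p ∨ q) ≡ (not p ∧ not q)
  not-∨ true  q = refl
  not-∨ false q = refl

  ∧-trueˡ : ∀ a b → (a ∧ b) ≡ true → a ≡ true
  ∧-trueˡ true b _ = refl

  ∧-trueʳ : ∀ a b → (a ∧ b) ≡ true → b ≡ true
  ∧-trueʳ true b a∧b = a∧b

  <ᵇ-true : ∀ a b → a < b → (a <ᵇ b) ≡ true
  <ᵇ-true zero    (suc b) _         = refl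
  <ᵇ-true (suc a) (suc b) (s≤s a<b) = <ᵇ-true a b a<b

  <ᵇ-false : ∀ a b → b ≤ a → (a <ᵇ b) ≡ false
  <ᵇ-false a       zero    _         = refl
  <ᵇ-false (suc a) (suc b) (s≤s b≤a) = <ᵇ-false a b b≤a

  ≡ᵇ-refl : ∀ a → (a ≡ᵇ a) ≡ true
  ≡ᵇ-refl zero    = refl
  ≡ᵇ-refl (suc a) = ≡ᵇ-refl a

  ≡ᵇ-sound : ∀ a b → (a ≡ᵇ b) ≡ true → a ≡ b
  ≡ᵇ-sound zero    zero    _   = refl
  ≡ᵇ-sound (suc a) (suc b) a≡b = cong suc (≡ᵇ-sound a b a≡b)

  ≡ᵇ-sym : ∀ a b → (a ≡ᵇ b) ≡ (b ≡ᵇ a)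
  ≡ᵇ-sym zero    zero    = refl
  ≡ᵇ-sym zero    (suc b) = refl
  ≡ᵇ-sym (suc a) zero    = refl
  ≡ᵇ-sym (suc a) (suc b) = ≡ᵇ-sym a b

  ≡ᵇ-false : ∀ a b → ¬ a ≡ b → (a ≡ᵇ b) ≡ false
  ≡ᵇ-false a b a≢b with a ≡ᵇ b in eq
  ... | true  = ⊥-elim (a≢b (≡ᵇ-sound a b eq))
  ... | false = refl

module Relabelling where
  open ListSums
  open Arrangements
  open BooleanFacts
  open import Data.Nat using (ℕ; zero; suc; _<_; _<ᵇ_)
  import Data.Nat.Properties as ℕₚ
  open import Data.Bool using (Bool; false)
  open import Data.List using (List; []; _∷_; map; length; zip)
  open import Data.List.Relation.Unary.All as All using (All; []; _∷_)
  open import Data.List.Relation.Unary.Any using (here; there)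
  open import Data.List.Membership.Propositional using (_∈_)
  open import Data.Product using (_×_; _,_; proj₁; proj₂)
  open import Data.Unit using (⊤)
  open import Function using (_∘_)
  open import Relation.Binary.PropositionalEquality
  open ≡-Reasoning

  -- descentAt j w: w has a descent between its entries j and j+1 (counting from 0).
  descentAt : ℕ → List ℕ → Bool
  descentAt j       []          = false
  descentAt j       (x ∷ [])    = false
  descentAt zero    (x ∷ y ∷ r) = y <ᵇ x
  descentAt (suc j) (x ∷ y ∷ r) = descentAt j (y ∷ r)

  -- Strictly increasing lists, i.e. finite sets listed in increasing order.
  Increasing : List ℕ → Set
  Increasing []       = ⊤
  Increasing (x ∷ xs) = All (x <_) xs × Increasing xs

  OrderPreserving : List (ℕ × ℕ) → Set
  OrderPreserving P = ∀ {a b} → a ∈ P → b ∈ P → (proj₁ b <ᵇ proj₁ a) ≡ (proj₂ b <ᵇ proj₂ a)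

  DescentInvariant : (List ℕ → ℕ) → Set
  DescentInvariant G = ∀ u v → (∀ j → descentAt j u ≡ descentAt j v) → G u ≡ G v

  proj₁-zip : ∀ (S T : List ℕ) → length S ≡ length T → map proj₁ (zip S T) ≡ S
  proj₁-zip []      []      _ = refl
  proj₁-zip (s ∷ S) (t ∷ T) e = cong (s ∷_) (proj₁-zip S T (ℕₚ.suc-injective e))

  proj₂-zip : ∀ (S T : List ℕ) → length S ≡ length T → map proj₂ (zip S T) ≡ T
  proj₂-zip []      []      _ = refl
  proj₂-zip (s ∷ S) (t ∷ T) e = cong (t ∷_) (proj₂-zip S T (ℕₚ.suc-injective e))

  ∈-zip : ∀ (S T : List ℕ) {a} → a ∈ zip S T → proj₁ a ∈ S × proj₂ a ∈ T
  ∈-zip (s ∷ S) (t ∷ T) (here refl) = here refl , here refl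
  ∈-zip (s ∷ S) (t ∷ T) (there a∈) with ∈-zip S T a∈
  ... | (a∈S , a∈T) = there a∈S , there a∈T

  zip-orderPreserving : ∀ S T → Increasing S → Increasing T → OrderPreserving (zip S T)
  zip-orderPreserving (s ∷ S) (t ∷ T) _ _ (here refl) (here refl) =
    trans (<ᵇ-false s s ℕₚ.≤-refl) (sym (<ᵇ-false t t ℕₚ.≤-refl))
  zip-orderPreserving (s ∷ S) (t ∷ T) (s<S , _) (t<T , _) (here refl) (there b∈) with ∈-zip S T b∈
  ... | (u , v) = trans (<ᵇ-false _ _ (ℕₚ.<⇒≤ (All.lookup s<S u))) (sym (<ᵇ-false _ _ (ℕₚ.<⇒≤ (All.lookup t<T v))))
  zip-orderPreserving (s ∷ S) (t ∷ T) (s<S , _) (t<T , _) (there a∈) (here refl) with ∈-zip S T a∈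
  ... | (u , v) = trans (<ᵇ-true _ _ (All.lookup s<S u)) (sym (<ᵇ-true _ _ (All.lookup t<T v)))
  zip-orderPreserving (s ∷ S) (t ∷ T) (_ , iS) (_ , iT) (there a∈) (there b∈) = zip-orderPreserving S T iS iT a∈ b∈

  descentAt-relabel : ∀ P → OrderPreserving P → ∀ w → All (_∈ P) w →
    ∀ j → descentAt j (map proj₁ w) ≡ descentAt j (map proj₂ w)
  descentAt-relabel P op []          _               j       = refl
  descentAt-relabel P op (x ∷ [])    _               j       = refl
  descentAt-relabel P op (x ∷ y ∷ r) (x∈ ∷ y∈ ∷ _)   zero    = op x∈ y∈
  descentAt-relabel P op (x ∷ y ∷ r) (_ ∷ w⊆)        (suc j) = descentAt-relabel P op (y ∷ r) w⊆ j

  orderings-relabel : ∀ S T (G : List ℕ → ℕ) → DescentInvariant G → Increasing S → Increasing T →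
    length S ≡ length T → ∑ (orderings S) G ≡ ∑ (orderings T) G
  orderings-relabel S T G inv iS iT e = begin
    ∑ (arrangements S (length S)) G
      ≡⟨ cong (λ L → ∑ (arrangements L (length S)) G) (sym (proj₁-zip S T e)) ⟩
    ∑ (arrangements (map proj₁ P) (length S)) G
      ≡⟨ ∑-arrangements-map proj₁ (length S) P G ⟩
    ∑ (arrangements P (length S)) (G ∘ map proj₁)
      ≡⟨ ∑-congᴬ _ _ (All.map (λ {w} w⊆P → inv _ _ (descentAt-relabel P (zip-orderPreserving S T iS iT) w w⊆P))
                              (arrangements-⊆ P (length S))) ⟩
    ∑ (arrangements P (length S)) (G ∘ map proj₂)
      ≡⟨ sym (∑-arrangements-map proj₂ (length S) P G) ⟩
    ∑ (arrangements (map proj₂ P) (length S)) G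
      ≡⟨ cong₂ (λ L k → ∑ (arrangements L k) G) (proj₂-zip S T e) e ⟩
    ∑ (arrangements T (length T)) G
      ∎
    where
    P = zip S T

module AscendingOrderings where
  open ListSums
  open Arrangements
  open BooleanFacts
  open Relabelling using (Increasing)
  open import Data.Nat using (ℕ; zero; suc; _+_; _<_; _≤_; _<ᵇ_; z≤n; s≤s)
  import Data.Nat.Properties as ℕₚ
  open import Data.Bool using (Bool; true; false; not; _∧_)
  open import Data.List using (List; []; _∷_; map; length)
  open import Data.List.Relation.Unary.All as All using (All; []; _∷_)
  open import Data.List.Relation.Unary.Any using (here)
  open import Data.List.Membership.Propositional using (_∈_)
  open import Data.Product using (_,_; proj₁; proj₂)
  open import Data.Empty using (⊥-elim)
  open import Relation.Binary.PropositionalEquality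
  open ≡-Reasoning

  ascending : List ℕ → Bool
  ascending []          = true
  ascending (x ∷ [])    = true
  ascending (x ∷ y ∷ r) = not (y <ᵇ x) ∧ ascending (y ∷ r)

  ≤-from-not-< : ∀ a b → not (b <ᵇ a) ≡ true → a ≤ b
  ≤-from-not-< zero    b       _ = z≤n
  ≤-from-not-< (suc a) (suc b) h = s≤s (≤-from-not-< a b h)

  ascending-head : ∀ y w → ascending (y ∷ w) ≡ true → All (y ≤_) w
  ascending-head y []      _   = []
  ascending-head y (z ∷ r) asc = y≤z ∷ All.map (ℕₚ.≤-trans y≤z) (ascending-head z r (∧-trueʳ _ _ asc))
    where y≤z = ≤-from-not-< y z (∧-trueˡ _ _ asc)

  ascending-cons : ∀ x w → All (x <_) w → ascending (x ∷ w) ≡ ascending w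
  ascending-cons x []      _         = refl
  ascending-cons x (z ∷ r) (x<z ∷ _) rewrite <ᵇ-false z x (ℕₚ.<⇒≤ x<z) = refl

  unique-ascending-ordering : ∀ R → Increasing R → ∑ (orderings R) (λ v → 𝟙 (ascending v)) ≡ 1
  unique-ascending-ordering []       _          = refl
  unique-ascending-ordering (x ∷ xs) (x<xs , increasing) =
    trans (∑-arrangements-suc (x ∷ xs) (length xs) (λ v → 𝟙 (ascending v))) (cong₂ _+_ x-first other-first)
    where
    x-first : ∑ (arrangements xs (length xs)) (λ w → 𝟙 (ascending (x ∷ w))) ≡ 1
    x-first = trans (∑-congᴬ _ _ (All.map (λ {w} w⊆xs → cong 𝟙 (ascending-cons x w (All.map (All.lookup x<xs) w⊆xs)))
                                          (arrangements-⊆ xs (length xs))))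
                    (unique-ascending-ordering xs increasing)
    larger-head : ∀ y w → x < y → x ∈ w → 𝟙 (ascending (y ∷ w)) ≡ 0
    larger-head y w x<y x∈w with ascending (y ∷ w) in asc
    ... | false = refl
    ... | true  = ⊥-elim (ℕₚ.<⇒≱ x<y (All.lookup (ascending-head y w asc) x∈w))
    later-head : ∀ y rest → y ∈ xs → suc (length rest) ≡ length xs →
      ∑ (arrangements (x ∷ rest) (length xs)) (λ w → 𝟙 (ascending (y ∷ w))) ≡ 0
    later-head y rest y∈xs len = begin
      ∑ (arrangements (x ∷ rest) (length xs)) (λ w → 𝟙 (ascending (y ∷ w)))
        ≡⟨ cong (λ k → ∑ (arrangements (x ∷ rest) k) (λ w → 𝟙 (ascending (y ∷ w)))) (sym len) ⟩
      ∑ (orderings (x ∷ rest)) (λ w → 𝟙 (ascending (y ∷ w)))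
        ≡⟨ ∑-congᴬ _ _ (All.map (λ {w} L⊆w → larger-head y w (All.lookup x<xs y∈xs) (All.lookup L⊆w (here refl)))
                                (orderings-⊇ (x ∷ rest))) ⟩
      ∑ (orderings (x ∷ rest)) (λ _ → 0)
        ≡⟨ ∑-zero (orderings (x ∷ rest)) ⟩
      0
        ∎
    other-first : ∑ (map (λ p → proj₁ p , x ∷ proj₂ p) (picks xs))
                    (λ p → ∑ (arrangements (proj₂ p) (length xs)) (λ w → 𝟙 (ascending (proj₁ p ∷ w)))) ≡ 0
    other-first = trans (∑-map _ (picks xs) _)
      (trans (∑-congᴬ _ (λ _ → 0) (All.zipWith (λ { {y , rest} ((y∈xs , _) , len) → later-head y rest y∈xs len })
                                               (picks-⊆ xs , picks-length xs)))
             (∑-zero (picks xs)))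

module PermutationsAsOrderings where
  open ListSums
  open Arrangements
  open BooleanFacts
  open import Data.Nat using (ℕ; zero; suc; _+_; _*_; _<_; _≡ᵇ_)
  import Data.Nat.Properties as ℕₚ
  open import Data.Bool using (Bool; true; false; not; _∧_; _∨_; T?)
  open import Data.Bool.Properties using (∨-zeroʳ; ∨-conicalˡ; ∨-conicalʳ; ∧-identityʳ)
  open import Data.Bool.Solver using (module ∨-∧-Solver)
  open import Data.List using (List; []; _∷_; map; concatMap; length; filter; applyUpTo)
  open import Data.List.Properties using (length-applyUpTo)
  open import Data.List.Relation.Unary.All as All using (All; []; _∷_)
  open import Data.List.Relation.Unary.All.Properties using (map⁺; concat⁺)
  open import Data.Product using (_×_; _,_; proj₁; proj₂)
  open import Data.Empty using (⊥; ⊥-elim)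
  open import Function using (_∘_)
  open import Relation.Binary.PropositionalEquality
  open ≡-Reasoning

  elem-remove : ∀ z a T → elem z (remove a T) ≡ (not (z ≡ᵇ a) ∧ elem z T)
  elem-remove z a []       with z ≡ᵇ a
  ... | true  = refl
  ... | false = refl
  elem-remove z a (y ∷ ys) with y ≡ᵇ a in y≟a
  ... | true  rewrite elem-remove z a ys = absorb (z ≡ᵇ a) (z ≡ᵇ y) (elem z ys) z≡y⇒z≡a
    where
    z≡y⇒z≡a : (z ≡ᵇ y) ≡ true → (z ≡ᵇ a) ≡ true
    z≡y⇒z≡a z≡y rewrite ≡ᵇ-sound z y z≡y = y≟a
    absorb : ∀ p q r → (q ≡ true → p ≡ true) → (not p ∧ r) ≡ (not p ∧ (q ∨ r))
    absorb true  q     r _ = refl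
    absorb false true  r h with h refl
    ... | ()
    absorb false false r _ = refl
  ... | false rewrite elem-remove z a ys = absorb (z ≡ᵇ a) (z ≡ᵇ y) (elem z ys) z≡y⇒z≢a
    where
    z≡y⇒z≢a : (z ≡ᵇ y) ≡ true → (z ≡ᵇ a) ≡ false
    z≡y⇒z≢a z≡y rewrite ≡ᵇ-sound z y z≡y = y≟a
    absorb : ∀ p q r → (q ≡ true → p ≡ false) → (q ∨ (not p ∧ r)) ≡ (not p ∧ (q ∨ r))
    absorb p     false r _ = refl
    absorb true  true  r h with h refl
    ... | ()
    absorb false true  r _ = refl

  elem-self : ∀ L → All (λ a → elem a L ≡ true) L
  elem-self []       = []
  elem-self (x ∷ xs) =
    cong (_∨ elem x xs) (≡ᵇ-refl x) ∷ All.map (λ {y} e → trans (cong ((y ≡ᵇ x) ∨_) e) (∨-zeroʳ (y ≡ᵇ x))) (elem-self xs)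

  remove-absent : ∀ x xs → elem x xs ≡ false → remove x xs ≡ xs
  remove-absent x []       _ = refl
  remove-absent x (y ∷ ys) x∉ with y ≡ᵇ x in y≟x
  ... | true  = ⊥-elim (true≢false (trans (sym y≟x) (trans (≡ᵇ-sym y x) (∨-conicalˡ (x ≡ᵇ y) _ x∉))))
    where
    true≢false : true ≡ false → ⊥
    true≢false ()
  ... | false = cong (y ∷_) (remove-absent x ys (∨-conicalʳ (x ≡ᵇ y) _ x∉))

  remove-other : ∀ x y xs → (y ≡ᵇ x) ≡ false → remove y (x ∷ xs) ≡ x ∷ remove y xs
  remove-other x y xs y≢x rewrite ≡ᵇ-sym x y | y≢x = refl

  distinct-remove : ∀ a T → distinct T ≡ true → distinct (remove a T) ≡ true
  distinct-remove a []       _ = refl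
  distinct-remove a (y ∷ ys) d with y ≡ᵇ a in y≟a
  ... | true  = distinct-remove a ys (∧-trueʳ _ _ d)
  ... | false rewrite elem-remove y a ys | y≟a | distinct-remove a ys (∧-trueʳ _ _ d) =
    trans (cong (not (elem y ys) ∧_) (sym (∧-trueʳ _ _ d))) d

  head-absent : ∀ x xs → distinct (x ∷ xs) ≡ true → elem x xs ≡ false
  head-absent x xs d with elem x xs | ∧-trueˡ (not (elem x xs)) (distinct xs) d
  ... | false | _ = refl

  ∑-cong-elem : ∀ L (f g : ℕ → ℕ) → (∀ y → elem y L ≡ true → f y ≡ g y) → ∑ L f ≡ ∑ L g
  ∑-cong-elem L f g f≗g = ∑-congᴬ f g (All.map (λ {y} → f≗g y) (elem-self L))

  ∑-picks-distinct : ∀ T (G : ℕ × List ℕ → ℕ) → distinct T ≡ true →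
    ∑ (picks T) G ≡ ∑ T (λ y → G (y , remove y T))
  ∑-picks-distinct []       G _ = refl
  ∑-picks-distinct (x ∷ xs) G d =
    cong₂ _+_ (cong (λ r → G (x , r)) (sym (trans remove-head (remove-absent x xs x∉xs))))
      (trans (∑-map _ (picks xs) G)
        (trans (∑-picks-distinct xs (λ p → G (proj₁ p , x ∷ proj₂ p)) (∧-trueʳ _ _ d))
          (∑-cong-elem xs _ _ (λ y y∈ → cong (λ r → G (y , r)) (sym (remove-other x y xs (y≢x y y∈)))))))
    where
    x∉xs = head-absent x xs d
    remove-head : remove x (x ∷ xs) ≡ remove x xs
    remove-head rewrite ≡ᵇ-refl x = refl
    y≢x : ∀ y → elem y xs ≡ true → (y ≡ᵇ x) ≡ false
    y≢x y y∈ with y ≡ᵇ x in y≟x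
    ... | false = refl
    ... | true rewrite ≡ᵇ-sound y x y≟x with trans (sym y∈) x∉xs
    ... | ()

  occurrences : ∀ a L → distinct L ≡ true → ∑ L (λ t → 𝟙 (a ≡ᵇ t)) ≡ 𝟙 (elem a L)
  occurrences a []       _ = refl
  occurrences a (x ∷ xs) d with a ≡ᵇ x in a≟x
  ... | true  = cong suc (trans (occurrences a xs (∧-trueʳ _ _ d))
                                (cong 𝟙 (trans (cong (λ z → elem z xs) (≡ᵇ-sound a x a≟x)) (head-absent x xs d))))
  ... | false = occurrences a xs (∧-trueʳ _ _ d)

  ∑-restrict : ∀ Alph T (G : ℕ → ℕ) → distinct Alph ≡ true → distinct T ≡ true →
    (∀ z → elem z T ≡ true → elem z Alph ≡ true) →
    ∑ Alph (λ a → 𝟙 (elem a T) * G a) ≡ ∑ T G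
  ∑-restrict Alph T G dAlph dT T⊆Alph = begin
    ∑ Alph (λ a → 𝟙 (elem a T) * G a)
      ≡⟨ ∑-cong Alph _ _ (λ a → trans (cong (_* G a) (sym (occurrences a T dT))) (sym (∑-*ʳ T _ (G a)))) ⟩
    ∑ Alph (λ a → ∑ T (λ t → 𝟙 (a ≡ᵇ t) * G a))
      ≡⟨ ∑-cong Alph _ _ (λ a → ∑-cong T _ _ (λ t → transport a t)) ⟩
    ∑ Alph (λ a → ∑ T (λ t → 𝟙 (a ≡ᵇ t) * G t))
      ≡⟨ ∑-comm Alph T _ ⟩
    ∑ T (λ t → ∑ Alph (λ a → 𝟙 (a ≡ᵇ t) * G t))
      ≡⟨ ∑-cong T _ _ (λ t → trans (∑-*ʳ Alph _ (G t)) (cong (_* G t) (occurs-in-alphabet t))) ⟩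
    ∑ T (λ t → 𝟙 (elem t Alph) * G t)
      ≡⟨ ∑-cong-elem T _ _ (λ t t∈T → trans (cong (λ b → 𝟙 b * G t) (T⊆Alph t t∈T)) (ℕₚ.*-identityˡ (G t))) ⟩
    ∑ T G
      ∎
    where
    occurs-in-alphabet : ∀ t → ∑ Alph (λ a → 𝟙 (a ≡ᵇ t)) ≡ 𝟙 (elem t Alph)
    occurs-in-alphabet t = trans (∑-cong Alph _ _ (λ a → cong 𝟙 (≡ᵇ-sym a t))) (occurrences t Alph dAlph)
    transport : ∀ a t → 𝟙 (a ≡ᵇ t) * G a ≡ 𝟙 (a ≡ᵇ t) * G t
    transport a t with a ≡ᵇ t in a≟t
    ... | true rewrite ≡ᵇ-sound a t a≟t = refl
    ... | false = refl

  allIn : List ℕ → List ℕ → Bool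
  allIn T []      = true
  allIn T (z ∷ w) = elem z T ∧ allIn T w

  allIn-remove : ∀ a T w → allIn (remove a T) w ≡ (not (elem a w) ∧ allIn T w)
  allIn-remove a T []      = refl
  allIn-remove a T (z ∷ w) rewrite elem-remove z a T | allIn-remove a T w | ≡ᵇ-sym z a | not-∨ (a ≡ᵇ z) (elem a w) =
    rearrange (not (a ≡ᵇ z)) (elem z T) (not (elem a w)) (allIn T w)
    where
    rearrange : ∀ p q r s → ((p ∧ q) ∧ (r ∧ s)) ≡ ((p ∧ r) ∧ (q ∧ s))
    rearrange = solve 4 (λ p q r s → (p :* q) :* (r :* s) := (p :* r) :* (q :* s)) refl
      where open ∨-∧-Solver

  distinct-allIn-cons : ∀ a w T →
    (distinct (a ∷ w) ∧ allIn T (a ∷ w)) ≡ (elem a T ∧ (distinct w ∧ allIn (remove a T) w))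
  distinct-allIn-cons a w T rewrite allIn-remove a T w =
    rearrange (not (elem a w)) (distinct w) (elem a T) (allIn T w)
    where
    rearrange : ∀ p q r s → ((p ∧ q) ∧ (r ∧ s)) ≡ (r ∧ (q ∧ (p ∧ s)))
    rearrange = solve 4 (λ p q r s → (p :* q) :* (r :* s) := r :* (q :* (p :* s))) refl
      where open ∨-∧-Solver

  words-allIn : ∀ n k → All (λ w → allIn (applyUpTo suc n) w ≡ true) (words n k)
  words-allIn n zero    = refl ∷ []
  words-allIn n (suc k) =
    concat⁺ (map⁺ (All.map (λ {w} w∈ → map⁺ (All.map (λ {a} a∈ → trans (cong (_∧ allIn (applyUpTo suc n) w) a∈) w∈)
                                                     (elem-self (applyUpTo suc n))))
                           (words-allIn n k)))

  StrictlyIncreasing : (ℕ → ℕ) → Set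
  StrictlyIncreasing f = ∀ i → f i < f (suc i)

  below-later-values : ∀ f → StrictlyIncreasing f → ∀ i → f 0 < f (suc i)
  below-later-values f inc zero    = inc 0
  below-later-values f inc (suc i) = ℕₚ.<-trans (below-later-values f inc i) (inc (suc i))

  elem-above : ∀ b g k → (∀ i → b < g i) → elem b (applyUpTo g k) ≡ false
  elem-above b g zero    b<g = refl
  elem-above b g (suc k) b<g =
    cong₂ _∨_ (≡ᵇ-false b (g 0) (ℕₚ.<⇒≢ (b<g 0))) (elem-above b (g ∘ suc) k (λ i → b<g (suc i)))

  distinct-values : ∀ f k → StrictlyIncreasing f → distinct (applyUpTo f k) ≡ true
  distinct-values f zero    inc = refl
  distinct-values f (suc k) inc rewrite elem-above (f 0) (f ∘ suc) k (below-later-values f inc) =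
    distinct-values (f ∘ suc) k (λ i → inc (suc i))

  module _ (n : ℕ) where
    private
      Alph = applyUpTo suc n

    ∑-distinct-words : ∀ k T (Q : List ℕ → ℕ) → distinct T ≡ true → (∀ z → elem z T ≡ true → elem z Alph ≡ true) →
      ∑ (words n k) (λ w → 𝟙 (distinct w ∧ allIn T w) * Q w) ≡ ∑ (arrangements T k) Q
    ∑-distinct-words zero    T Q _  _     = cong (_+ 0) (ℕₚ.+-identityʳ (Q []))
    ∑-distinct-words (suc k) T Q dT T⊆Alph = begin
      ∑ (concatMap (λ w → map (_∷ w) Alph) (words n k)) (λ w → 𝟙 (distinct w ∧ allIn T w) * Q w)
        ≡⟨ ∑-concatMap _ (words n k) _ ⟩
      ∑ (words n k) (λ w → ∑ (map (_∷ w) Alph) (λ w → 𝟙 (distinct w ∧ allIn T w) * Q w))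
        ≡⟨ ∑-cong (words n k) _ _ (λ w → trans (∑-map (_∷ w) Alph _) (∑-cong Alph _ _ (λ a → first-letter a w))) ⟩
      ∑ (words n k) (λ w → ∑ Alph (λ a → 𝟙 (elem a T) * (𝟙 (distinct w ∧ allIn (remove a T) w) * Q (a ∷ w))))
        ≡⟨ ∑-comm (words n k) Alph _ ⟩
      ∑ Alph (λ a → ∑ (words n k) (λ w → 𝟙 (elem a T) * (𝟙 (distinct w ∧ allIn (remove a T) w) * Q (a ∷ w))))
        ≡⟨ ∑-cong Alph _ _ (λ a → trans (∑-*ˡ (words n k) _ (𝟙 (elem a T))) (cong (𝟙 (elem a T) *_) (rest a))) ⟩
      ∑ Alph (λ a → 𝟙 (elem a T) * ∑ (arrangements (remove a T) k) (λ w → Q (a ∷ w)))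
        ≡⟨ ∑-restrict Alph T _ (distinct-values suc n (λ i → ℕₚ.≤-refl)) dT T⊆Alph ⟩
      ∑ T (λ a → ∑ (arrangements (remove a T) k) (λ w → Q (a ∷ w)))
        ≡⟨ sym (∑-picks-distinct T (λ p → ∑ (arrangements (proj₂ p) k) (λ w → Q (proj₁ p ∷ w))) dT) ⟩
      ∑ (picks T) (λ p → ∑ (arrangements (proj₂ p) k) (λ w → Q (proj₁ p ∷ w)))
        ≡⟨ sym (∑-arrangements-suc T k Q) ⟩
      ∑ (arrangements T (suc k)) Q
        ∎
      where
      first-letter : ∀ a w → 𝟙 (distinct (a ∷ w) ∧ allIn T (a ∷ w)) * Q (a ∷ w)
                           ≡ 𝟙 (elem a T) * (𝟙 (distinct w ∧ allIn (remove a T) w) * Q (a ∷ w))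
      first-letter a w rewrite distinct-allIn-cons a w T | 𝟙-∧ (elem a T) (distinct w ∧ allIn (remove a T) w) =
        ℕₚ.*-assoc (𝟙 (elem a T)) _ (Q (a ∷ w))
      rest : ∀ a → ∑ (words n k) (λ w → 𝟙 (distinct w ∧ allIn (remove a T) w) * Q (a ∷ w))
                 ≡ ∑ (arrangements (remove a T) k) (λ w → Q (a ∷ w))
      rest a = ∑-distinct-words k (remove a T) (λ w → Q (a ∷ w)) (distinct-remove a T dT)
                 (λ z z∈ → T⊆Alph z (∧-trueʳ _ _ (trans (sym (elem-remove z a T)) z∈)))

    dCount-as-orderings : ∀ J → dCount J n ≡ ∑ (orderings Alph) (λ π → 𝟙 (hasDescentSet n J π))
    dCount-as-orderings J = begin
      length (filter (λ π → T? (hasDescentSet n J π)) (filter (λ w → T? (distinct w)) (words n n)))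
        ≡⟨ count-filters (words n n) ⟩
      ∑ (words n n) (λ w → 𝟙 (distinct w) * 𝟙 (hasDescentSet n J w))
        ≡⟨ ∑-congᴬ _ _ (All.map (λ {w} w⊆ → cong (λ b → 𝟙 b * 𝟙 (hasDescentSet n J w))
                                                  (sym (trans (cong (distinct w ∧_) w⊆) (∧-identityʳ (distinct w)))))
                               (words-allIn n n)) ⟩
      ∑ (words n n) (λ w → 𝟙 (distinct w ∧ allIn Alph w) * 𝟙 (hasDescentSet n J w))
        ≡⟨ ∑-distinct-words n Alph _ (distinct-values suc n (λ i → ℕₚ.≤-refl)) (λ z z∈ → z∈) ⟩
      ∑ (arrangements Alph n) (λ π → 𝟙 (hasDescentSet n J π))
        ≡⟨ cong (λ k → ∑ (arrangements Alph k) (λ π → 𝟙 (hasDescentSet n J π))) (sym (length-applyUpTo suc n)) ⟩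
      ∑ (orderings Alph) (λ π → 𝟙 (hasDescentSet n J π))
        ∎
      where
      count-filters : ∀ L → length (filter (λ π → T? (hasDescentSet n J π)) (filter (λ w → T? (distinct w)) L))
                          ≡ ∑ L (λ w → 𝟙 (distinct w) * 𝟙 (hasDescentSet n J w))
      count-filters []       = refl
      count-filters (x ∷ xs) with distinct x
      ... | false = count-filters xs
      ... | true with hasDescentSet n J x
      ...   | true  = cong suc (count-filters xs)
      ...   | false = count-filters xs

module DescentSets where
  open BooleanFacts
  open Relabelling using (descentAt)
  open AscendingOrderings using (ascending)
  open import Data.Nat using (ℕ; zero; suc; _+_; _<_; _≤_; _∸_; _<ᵇ_; z≤n; s≤s)
  import Data.Nat.Properties as ℕₚ
  open import Data.Bool using (Bool; true; false; not; _∧_; _∨_; if_then_else_)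
  open import Data.Bool.Properties using (∧-assoc)
  open import Data.Bool.ListAction using (all)
  open import Data.List using ([]; _∷_; length; _++_; applyUpTo)
  open import Data.List.Relation.Unary.All as All using (All; []; _∷_)
  open import Data.Product using (_,_)
  open import Function using (_∘_)
  open import Relation.Nullary using (¬_)
  open import Relation.Binary.PropositionalEquality

  allBelow : (ℕ → Bool) → ℕ → Bool
  allBelow h zero    = true
  allBelow h (suc K) = h 0 ∧ allBelow (h ∘ suc) K

  all-applyUpTo : ∀ (f : ℕ → Bool) g K → all f (applyUpTo g K) ≡ allBelow (f ∘ g) K
  all-applyUpTo f g zero    = refl
  all-applyUpTo f g (suc K) = cong (f (g 0) ∧_) (all-applyUpTo f (g ∘ suc) K)

  allBelow-cong : ∀ K (h h′ : ℕ → Bool) → (∀ j → j < K → h j ≡ h′ j) → allBelow h K ≡ allBelow h′ K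
  allBelow-cong zero    h h′ h≗h′ = refl
  allBelow-cong (suc K) h h′ h≗h′ =
    cong₂ _∧_ (h≗h′ 0 (s≤s z≤n)) (allBelow-cong K (h ∘ suc) (h′ ∘ suc) (λ j j<K → h≗h′ (suc j) (s≤s j<K)))

  allBelow-+ : ∀ a b (h : ℕ → Bool) → allBelow h (a + b) ≡ (allBelow h a ∧ allBelow (λ i → h (a + i)) b)
  allBelow-+ zero    b h = refl
  allBelow-+ (suc a) b h = trans (cong (h 0 ∧_) (allBelow-+ a b (h ∘ suc))) (sym (∧-assoc (h 0) _ _))

  allBelow-ascending : ∀ v K → length v ≡ suc K → allBelow (λ i → not (descentAt i v)) K ≡ ascending v
  allBelow-ascending (x ∷ [])    zero    _ = refl
  allBelow-ascending (x ∷ y ∷ r) (suc K) e = cong (not (y <ᵇ x) ∧_) (allBelow-ascending (y ∷ r) K (ℕₚ.suc-injective e))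

  descentsFrom-below : ∀ i s π → i < s → elem i (descentsFrom s π) ≡ false
  descentsFrom-below i s []          _   = refl
  descentsFrom-below i s (x ∷ [])    _   = refl
  descentsFrom-below i s (x ∷ y ∷ r) i<s = if-cons (y <ᵇ x) (descentsFrom-below i (suc s) (y ∷ r) (ℕₚ.m≤n⇒m≤1+n i<s))
    where
    D = descentsFrom (suc s) (y ∷ r)
    if-cons : ∀ b → elem i D ≡ false → elem i (if b then s ∷ D else D) ≡ false
    if-cons true  i∉D = cong₂ _∨_ (≡ᵇ-false i s (ℕₚ.<⇒≢ i<s)) i∉D
    if-cons false i∉D = i∉D

  elem-descentsFrom : ∀ s j π → elem (s + j) (descentsFrom s π) ≡ descentAt j π
  elem-descentsFrom s j       []          = refl
  elem-descentsFrom s j       (x ∷ [])    = refl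
  elem-descentsFrom s zero    (x ∷ y ∷ r) with y <ᵇ x
  ... | true  rewrite ℕₚ.+-identityʳ s | ≡ᵇ-refl s = refl
  ... | false rewrite ℕₚ.+-identityʳ s = descentsFrom-below s (suc s) (y ∷ r) ℕₚ.≤-refl
  elem-descentsFrom s (suc j) (x ∷ y ∷ r) with y <ᵇ x
  ... | true  rewrite ℕₚ.+-suc s j | ≡ᵇ-false (suc (s + j)) s (ℕₚ.m+1+n≢m s ∘ trans (ℕₚ.+-suc s j)) = elem-descentsFrom (suc s) j (y ∷ r)
  ... | false rewrite ℕₚ.+-suc s j = elem-descentsFrom (suc s) j (y ∷ r)

  descentAt-++ˡ : ∀ u v j → suc j < length u → descentAt j (u ++ v) ≡ descentAt j u
  descentAt-++ˡ (x ∷ [])    v j       (s≤s ())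
  descentAt-++ˡ (x ∷ y ∷ r) v zero    _         = refl
  descentAt-++ˡ (x ∷ y ∷ r) v (suc j) (s≤s j<)  = descentAt-++ˡ (y ∷ r) v j j<

  descentAt-++ʳ : ∀ x u v j → descentAt (length (x ∷ u) + j) ((x ∷ u) ++ v) ≡ descentAt j v
  descentAt-++ʳ x []      []      j = refl
  descentAt-++ʳ x []      (y ∷ r) j = refl
  descentAt-++ʳ x (y ∷ u) v       j = descentAt-++ʳ y u v j

  all-true : ∀ (f : ℕ → Bool) L → All (λ x → f x ≡ true) L → all f L ≡ true
  all-true f []       _        = refl
  all-true f (x ∷ xs) (fx ∷ ps) rewrite fx = all-true f xs ps

  hasDescentSet-positions : ∀ n J π → All (1 ≤_) J → All (_< n) J →
    hasDescentSet n J π ≡ allBelow (λ j → boolEq (elem (suc j) J) (descentAt j π)) (n ∸ 1)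
  hasDescentSet-positions n J π J≥1 J<n
    rewrite all-true (λ j → (0 <ᵇ j) ∧ (j <ᵇ n)) J
              (All.zipWith (λ { {j} (0<j , j<n) → cong₂ _∧_ (<ᵇ-true 0 j 0<j) (<ᵇ-true j n j<n) }) (J≥1 , J<n)) =
    trans (all-applyUpTo _ suc (n ∸ 1))
          (allBelow-cong (n ∸ 1) _ _ (λ j _ → cong (boolEq (elem (suc j) J)) (elem-descentsFrom 1 j π)))

  allBelow-toggle : ∀ p K → p < K → (hI hA hQ : ℕ → Bool) →
    (∀ j → ¬ j ≡ p → hI j ≡ hA j) → (∀ j → ¬ j ≡ p → hQ j ≡ hA j) →
    hI p ≡ not (hA p) → hQ p ≡ true →
    𝟙 (allBelow hI K) + 𝟙 (allBelow hA K) ≡ 𝟙 (allBelow hQ K)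
  allBelow-toggle zero (suc K) _ hI hA hQ I≗A Q≗A toggled set
    rewrite toggled | set
          | allBelow-cong K (hI ∘ suc) (hA ∘ suc) (λ j _ → I≗A (suc j) (λ ()))
          | allBelow-cong K (hQ ∘ suc) (hA ∘ suc) (λ j _ → Q≗A (suc j) (λ ()))
    with hA 0 | allBelow (hA ∘ suc) K
  ... | true  | true  = refl
  ... | true  | false = refl
  ... | false | true  = refl
  ... | false | false = refl
  allBelow-toggle (suc p) (suc K) (s≤s p<K) hI hA hQ I≗A Q≗A toggled set
    rewrite I≗A 0 (λ ()) | Q≗A 0 (λ ()) with hA 0
  ... | false = refl
  ... | true  = allBelow-toggle p K p<K (hI ∘ suc) (hA ∘ suc) (hQ ∘ suc)
                  (λ j j≢p → I≗A (suc j) (j≢p ∘ ℕₚ.suc-injective))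
                  (λ j j≢p → Q≗A (suc j) (j≢p ∘ ℕₚ.suc-injective)) toggled set

module DescentRecursion where
  open ListSums
  open Arrangements
  open BooleanFacts
  open Relabelling
  open AscendingOrderings
  open PermutationsAsOrderings
  open DescentSets
  open import Data.Nat using (ℕ; zero; suc; _+_; _*_; _<_; _≤_; _∸_; _≡ᵇ_; z≤n; s≤s)
  import Data.Nat.Properties as ℕₚ
  open import Data.Nat.Combinatorics using (_C_)
  open import Data.Bool using (Bool; true; false; not; _∧_; _∨_)
  open import Data.List using (List; []; _∷_; length; _++_; applyUpTo)
  open import Data.List.Properties using (length-applyUpTo)
  open import Data.List.Relation.Unary.All as All using (All; []; _∷_)
  open import Data.List.Relation.Unary.All.Properties using (map⁺; ++⁺; filter⁺; all-filter; applyUpTo⁺₂)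
  open import Data.Product using (_×_; _,_; proj₁; proj₂)
  open import Data.Unit using (tt)
  open import Function using (_∘_)
  open import Relation.Nullary using (¬_; ¬?)
  open import Relation.Binary.PropositionalEquality
  open ≡-Reasoning

  values-increasing : ∀ f k → StrictlyIncreasing f → Increasing (applyUpTo f k)
  values-increasing f zero    inc = tt
  values-increasing f (suc k) inc =
    applyUpTo⁺₂ (f ∘ suc) k (below-later-values f inc) , values-increasing (f ∘ suc) k (λ i → inc (suc i))

  splits-All : ∀ {P : ℕ → Set} m L → All P L → All (λ q → All P (proj₁ q) × All P (proj₂ q)) (splits m L)
  splits-All zero    L        PL         = ([] , PL) ∷ []
  splits-All (suc m) []       _          = []
  splits-All (suc m) (x ∷ xs) (Px ∷ Pxs) =
    ++⁺ (map⁺ (All.map (λ { (PS , PR) → Px ∷ PS , PR }) (splits-All m xs Pxs)))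
        (map⁺ (All.map (λ { (PS , PR) → PS , Px ∷ PR }) (splits-All (suc m) xs Pxs)))

  splits-increasing : ∀ m L → Increasing L → All (λ q → Increasing (proj₁ q) × Increasing (proj₂ q)) (splits m L)
  splits-increasing zero    L        incL          = (tt , incL) ∷ []
  splits-increasing (suc m) []       _             = []
  splits-increasing (suc m) (x ∷ xs) (x<xs , incxs) =
    ++⁺ (map⁺ (All.zipWith (λ { ((x<S , _) , (incS , incR)) → (x<S , incS) , incR })
                           (splits-All m xs x<xs , splits-increasing m xs incxs)))
        (map⁺ (All.zipWith (λ { ((_ , x<R) , (incS , incR)) → incS , (x<R , incR) })
                           (splits-All (suc m) xs x<xs , splits-increasing (suc m) xs incxs)))

  elem-beyond : ∀ b j L → All (_≤ b) L → b < j → elem j L ≡ false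
  elem-beyond b j []       _          _   = refl
  elem-beyond b j (x ∷ xs) (x≤b ∷ xs≤b) b<j =
    cong₂ _∨_ (≡ᵇ-false j x (λ j≡x → ℕₚ.<⇒≱ b<j (subst (_≤ b) (sym j≡x) x≤b))) (elem-beyond b j xs xs≤b b<j)

  upTo-increasing : ∀ k → Increasing (applyUpTo suc k)
  upTo-increasing k = values-increasing suc k (λ i → ℕₚ.≤-refl)

  module _ (I : List ℕ) (m′ : ℕ) (I≥1 : All (1 ≤_) I) (I≤m : All (_≤ suc m′) I) (m∈I : elem (suc m′) I ≡ true) where
    private
      m  = suc m′
      I⁻ = remove m I

    I⁻≥1 : All (1 ≤_) I⁻
    I⁻≥1 = filter⁺ _ I≥1

    I⁻≤m : All (_≤ m) I⁻
    I⁻≤m = filter⁺ _ I≤m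

    I⁻<m : All (_< m) I⁻
    I⁻<m = All.zipWith (λ { (j≤m , j≢m) → ℕₚ.≤∧≢⇒< j≤m j≢m }) (I⁻≤m , all-filter (λ x → ¬? (x ℕₚ.≟ m)) I)

    matchesI⁻ : List ℕ → ℕ → Bool
    matchesI⁻ π j = boolEq (elem (suc j) I⁻) (descentAt j π)

    matchesI⁻-off-m : List ℕ → ℕ → Bool
    matchesI⁻-off-m π j = (suc j ≡ᵇ m) ∨ matchesI⁻ π j

    hasI⁻ : List ℕ → Bool
    hasI⁻ u = allBelow (matchesI⁻ u) m′

    hasI⁻-invariant : DescentInvariant (𝟙 ∘ hasI⁻)
    hasI⁻-invariant u v same = cong 𝟙 (allBelow-cong m′ _ _ (λ j _ → cong (boolEq (elem (suc j) I⁻)) (same j)))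

    d⁻ : ℕ
    d⁻ = dCount I⁻ m

    d⁻-as-orderings : d⁻ ≡ ∑ (orderings (applyUpTo suc m)) (𝟙 ∘ hasI⁻)
    d⁻-as-orderings = trans (dCount-as-orderings m I⁻)
      (∑-cong (orderings (applyUpTo suc m)) _ _ (λ σ → cong 𝟙 (hasDescentSet-positions m I⁻ σ I⁻≥1 I⁻<m)))

    d⁻-relabelled : ∀ S → length S ≡ m → Increasing S → ∑ (orderings S) (𝟙 ∘ hasI⁻) ≡ d⁻
    d⁻-relabelled S |S| incS =
      trans (orderings-relabel S (applyUpTo suc m) _ hasI⁻-invariant incS (upTo-increasing m)
                               (trans |S| (sym (length-applyUpTo suc m))))
            (sym d⁻-as-orderings)

    module _ (t : ℕ) where
      private
        n = m + suc t

        within-n : ∀ {p} → p ≤ m → p < n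
        within-n p≤m = ℕₚ.≤-<-trans p≤m (ℕₚ.m<m+n m (s≤s z≤n))

      I-or-I⁻ : ∀ π → 𝟙 (hasDescentSet n I π) + 𝟙 (hasDescentSet n I⁻ π) ≡ 𝟙 (allBelow (matchesI⁻-off-m π) (m′ + suc t))
      I-or-I⁻ π rewrite hasDescentSet-positions n I π I≥1 (All.map within-n I≤m)
                      | hasDescentSet-positions n I⁻ π I⁻≥1 (All.map within-n I⁻≤m) =
        allBelow-toggle m′ (m′ + suc t) (ℕₚ.m<m+n m′ (s≤s z≤n)) _ _ _ agree-I agree-off toggled (cong (_∨ matchesI⁻ π m′) (≡ᵇ-refl m′))
        where
        agree-I : ∀ j → ¬ j ≡ m′ → boolEq (elem (suc j) I) (descentAt j π) ≡ matchesI⁻ π j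
        agree-I j j≢m′ rewrite elem-remove (suc j) m I | ≡ᵇ-false j m′ j≢m′ = refl
        agree-off : ∀ j → ¬ j ≡ m′ → matchesI⁻-off-m π j ≡ matchesI⁻ π j
        agree-off j j≢m′ rewrite ≡ᵇ-false j m′ j≢m′ = refl
        toggled : boolEq (elem m I) (descentAt m′ π) ≡ not (matchesI⁻ π m′)
        toggled rewrite elem-remove m m I | ≡ᵇ-refl m′ | m∈I = boolEq-true (descentAt m′ π)
          where
          boolEq-true : ∀ d → d ≡ not (boolEq false d)
          boolEq-true true  = refl
          boolEq-true false = refl

      offWeight : List ℕ → ℕ
      offWeight w = 𝟙 (allBelow (matchesI⁻-off-m w) (m′ + suc t))

      concatenation-weight : ∀ u v → length u ≡ m → length v ≡ suc t →
        offWeight (u ++ v) ≡ 𝟙 (hasI⁻ u) * 𝟙 (ascending v)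
      concatenation-weight (x ∷ u′) v |u| |v| =
        trans (cong 𝟙 (trans (allBelow-+ m′ (suc t) _) (cong₂ _∧_ left-part right-part))) (𝟙-∧ (hasI⁻ u) (ascending v))
        where
        u = x ∷ u′
        left-part : allBelow (matchesI⁻-off-m (u ++ v)) m′ ≡ hasI⁻ u
        left-part = allBelow-cong m′ _ _ λ j j<m′ →
          cong₂ _∨_ (≡ᵇ-false (suc j) m (ℕₚ.<⇒≢ j<m′ ∘ ℕₚ.suc-injective))
                    (cong (boolEq (elem (suc j) I⁻)) (descentAt-++ˡ u v j (subst (suc j <_) (sym |u|) (s≤s j<m′))))
        free-position : matchesI⁻-off-m (u ++ v) (m′ + 0) ≡ true
        free-position rewrite ℕₚ.+-identityʳ m′ | ≡ᵇ-refl m′ = refl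
        beyond-m : ∀ i → matchesI⁻-off-m (u ++ v) (m′ + suc i) ≡ not (descentAt i v)
        beyond-m i = cong₂ _∨_ (≡ᵇ-false (suc (m′ + suc i)) m (ℕₚ.m+1+n≢m m′ ∘ ℕₚ.suc-injective))
          (cong₂ boolEq (elem-beyond m (suc (m′ + suc i)) I⁻ I⁻≤m (s≤s (ℕₚ.m<m+n m′ (s≤s z≤n))))
                        (trans (cong (λ z → descentAt z (u ++ v)) (trans (ℕₚ.+-suc m′ i) (cong (_+ i) (sym |u|))))
                               (descentAt-++ʳ x u′ v i)))
        right-part : allBelow (λ i → matchesI⁻-off-m (u ++ v) (m′ + i)) (suc t) ≡ ascending v
        right-part = cong₂ _∧_ free-position (trans (allBelow-cong t _ _ (λ i _ → beyond-m i)) (allBelow-ascending v t |v|))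

      per-split : ∀ S R → length S ≡ m → length R ≡ suc t → Increasing S → Increasing R →
        ∑-concatenations S R offWeight ≡ d⁻
      per-split S R |S| |R| incS incR = begin
        ∑ (orderings S) (λ u → ∑ (orderings R) (λ v → offWeight (u ++ v)))
          ≡⟨ ∑-congᴬ _ _ (All.map (λ {u} |u| → ∑-congᴬ _ _ (All.map (λ {v} |v| →
                 concatenation-weight u v (trans |u| |S|) (trans |v| |R|)) (arrangements-length R (length R))))
                 (arrangements-length S (length S))) ⟩
        ∑ (orderings S) (λ u → ∑ (orderings R) (λ v → 𝟙 (hasI⁻ u) * 𝟙 (ascending v)))
          ≡⟨ ∑-cong (orderings S) _ _ (λ u → begin
               ∑ (orderings R) (λ v → 𝟙 (hasI⁻ u) * 𝟙 (ascending v)) ≡⟨ ∑-*ˡ (orderings R) (𝟙 ∘ ascending) (𝟙 (hasI⁻ u)) ⟩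
               𝟙 (hasI⁻ u) * ∑ (orderings R) (𝟙 ∘ ascending)       ≡⟨ cong (𝟙 (hasI⁻ u) *_) (unique-ascending-ordering R incR) ⟩
               𝟙 (hasI⁻ u) * 1                                      ≡⟨ ℕₚ.*-identityʳ _ ⟩
               𝟙 (hasI⁻ u)                                          ∎) ⟩
        ∑ (orderings S) (𝟙 ∘ hasI⁻)
          ≡⟨ d⁻-relabelled S |S| incS ⟩
        d⁻
          ∎

      descent-recursion : dCount I n + dCount I⁻ n ≡ (n C m) * d⁻
      descent-recursion = begin
        dCount I n + dCount I⁻ n
          ≡⟨ cong₂ _+_ (dCount-as-orderings n I) (dCount-as-orderings n I⁻) ⟩
        ∑ (orderings [n]) (𝟙 ∘ hasDescentSet n I) + ∑ (orderings [n]) (𝟙 ∘ hasDescentSet n I⁻)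
          ≡⟨ sym (∑-+ (orderings [n]) _ _) ⟩
        ∑ (orderings [n]) (λ π → 𝟙 (hasDescentSet n I π) + 𝟙 (hasDescentSet n I⁻ π))
          ≡⟨ ∑-cong (orderings [n]) _ _ I-or-I⁻ ⟩
        ∑ (orderings [n]) offWeight
          ≡⟨ orderings-split m [n] offWeight (subst (m ≤_) (sym |[n]|) (ℕₚ.m≤m+n m (suc t))) ⟩
        ∑ (splits m [n]) (λ q → ∑-concatenations (proj₁ q) (proj₂ q) offWeight)
          ≡⟨ ∑-congᴬ _ _ (All.zipWith (λ { {S , R} ((|S| , |S|+|R|) , (incS , incR)) →
                 per-split S R |S| (complement-length S R |S| |S|+|R|) incS incR })
                 (splits-length m [n] , splits-increasing m [n] (upTo-increasing n))) ⟩
        ∑ (splits m [n]) (λ _ → d⁻)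
          ≡⟨ ∑-const (splits m [n]) d⁻ ⟩
        length (splits m [n]) * d⁻
          ≡⟨ cong (_* d⁻) (trans (length-splits m [n]) (cong (_C m) |[n]|)) ⟩
        (n C m) * d⁻
          ∎
        where
        [n] = applyUpTo suc n
        |[n]| : length [n] ≡ n
        |[n]| = length-applyUpTo suc n
        complement-length : ∀ (S R : List ℕ) → length S ≡ m → length S + length R ≡ length [n] → length R ≡ suc t
        complement-length S R |S| |S|+|R| = ℕₚ.+-cancelˡ-≡ m _ _ (trans (cong (_+ length R) (sym |S|)) (trans |S|+|R| |[n]|))

  descent-recursion-above : ∀ I m′ → All (1 ≤_) I → All (_≤ suc m′) I → elem (suc m′) I ≡ true →
    ∀ n → suc m′ < n →
    dCount I n + dCount (remove (suc m′) I) n ≡ (n C suc m′) * dCount (remove (suc m′) I) (suc m′)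
  descent-recursion-above I m′ I≥1 I≤m m∈I n m<n =
    subst (λ n → dCount I n + dCount (remove (suc m′) I) n ≡ (n C suc m′) * dCount (remove (suc m′) I) (suc m′))
          (trans (ℕₚ.+-suc (suc m′) t) (ℕₚ.m+[n∸m]≡n m<n))
          (descent-recursion I m′ I≥1 I≤m m∈I t)
    where
    t = n ∸ suc (suc m′)

module Maximum where
  open BooleanFacts using (≡ᵇ-refl)
  open import Data.Nat using (suc; _+_; _*_; _<_; _≤_; z≤n)
  import Data.Nat.Properties as ℕₚ
  open import Data.Nat.Combinatorics using (_C_)
  open import Data.Bool using (true)
  open import Data.Bool.Properties using (∨-zeroʳ)
  open import Data.List using (List; []; _∷_)
  open import Data.List.Relation.Unary.All as All using (All; []; _∷_)
  open import Data.List.Relation.Unary.All.Properties using (filter⁺)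
  open import Data.Sum using (inj₁; inj₂)
  open import Data.Empty using (⊥-elim)
  open import Relation.Binary.PropositionalEquality

  mx-upper : ∀ L → All (_≤ mx L) L
  mx-upper []       = []
  mx-upper (x ∷ xs) = ℕₚ.m≤m⊔n x (mx xs) ∷ All.map (λ y≤ → ℕₚ.≤-trans y≤ (ℕₚ.m≤n⊔m x (mx xs))) (mx-upper xs)

  mx-least : ∀ L b → All (_≤ b) L → mx L ≤ b
  mx-least []       b _            = z≤n
  mx-least (x ∷ xs) b (x≤b ∷ xs≤b) = ℕₚ.⊔-lub x≤b (mx-least xs b xs≤b)

  mx-∈ : ∀ x xs → elem (mx (x ∷ xs)) (x ∷ xs) ≡ true
  mx-∈ x []       rewrite ℕₚ.⊔-identityʳ x | ≡ᵇ-refl x = refl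
  mx-∈ x (y ∷ ys) with ℕₚ.⊔-sel x (mx (y ∷ ys))
  ... | inj₁ x⊔≡x rewrite x⊔≡x | ≡ᵇ-refl x = refl
  ... | inj₂ x⊔≡  rewrite x⊔≡ | mx-∈ y ys = ∨-zeroʳ _

  mx-remove : ∀ a L → mx (remove a L) ≤ mx L
  mx-remove a L = mx-least (remove a L) (mx L) (filter⁺ _ (mx-upper L))

  recursion-at-max : ∀ I → I ≢ [] → All (1 ≤_) I → ∀ n → mx I < n →
    dCount I n + dCount (remove (mx I) I) n ≡ (n C mx I) * dCount (remove (mx I) I) (mx I)
  recursion-at-max []       I≢[] _   = ⊥-elim (I≢[] refl)
  recursion-at-max (x ∷ xs) _    I≥1@(x≥1 ∷ _)
    with mx (x ∷ xs) | mx-upper (x ∷ xs) | mx-∈ x xs | ℕₚ.≤-trans x≥1 (ℕₚ.m≤m⊔n x (mx xs))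
  ... | suc m′ | I≤m | m∈I | _ = DescentRecursion.descent-recursion-above (x ∷ xs) m′ I≥1 I≤m m∈I

open import Data.Product using (_,_)
open import Data.Nat using (ℕ; _≤_; _∸_)
open import Data.List using (List; [])
open import Data.List.Relation.Unary.All using (All)
open import Data.Integer using (ℤ; +_; _-_; _*_)
open import Relation.Binary.PropositionalEquality using (_≡_; _≢_)

open BinomialExpansions using (coefficient-recursion)
open Maximum using (mx-remove; recursion-at-max)

lemma3p2 : (I : List ℕ) → I ≢ [] → All (1 ≤_) I →
    (c c⁻ : ℕ → ℤ) → IsCoeffs I c → IsCoeffs (remove (mx I) I) c⁻ →
    ∀ k → k ≤ mx I →
    c k ≡ + dCount (remove (mx I) I) (mx I)
          - sgn (mx I ∸ mx (remove (mx I) I)) * c⁻ k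
lemma3p2 I I≢[] I≥1 c c⁻ (_ , c-expands) (c⁻-support , c⁻-expands) =
  coefficient-recursion (mx I) (mx I⁻) (dCount I) (dCount I⁻) (dCount I⁻ (mx I)) c c⁻
    (mx-remove (mx I) I) (recursion-at-max I I≢[] I≥1) c-expands c⁻-support c⁻-expands
  where
  I⁻ = remove (mx I) I
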